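{- (1) Let $\Delta_1,\Delta_2$ be flag 3-manifolds (on disjoint vertex sets), $e_1\in\Delta_1$, $e_2\in\Delta_2$ edges, and $\phi:\partial\operatorname{st}(e_1,\Delta_1)\to\partial\operatorname{st}(e_2,\Delta_2)$ a simplicial isomorphism. Let $\Delta_1\#_\phi\Delta_2$ be the complex obtained by removing the interior faces of $\operatorname{st}(e_1,\Delta_1)$ and $\operatorname{st}(e_2,\Delta_2)$ and identifying $\partial\operatorname{st}(e_1,\Delta_1)$ with $\partial\operatorname{st}(e_2,\Delta_2)$ via $\phi$. Then $$\gamma_2(\Delta_1\#_\phi\Delta_2)=\gamma_2(\Delta_1)+\gamma_2(\Delta_2)+2\gamma_1(\operatorname{lk}(e_1,\Delta_1)).$$ (2) Let $\Delta$ be a flag 3-manifold with edges $\sigma_1,\sigma_2$ and a simplicial isomorphism $\psi:\partial\operatorname{st}(\sigma_1,\Delta)\to\partial\operatorname{st}(\sigma_2,\Delta)$ such that $W_i=V(\operatorname{st}(\sigma_i,\Delta))$ satisfy $\operatorname{dist}(u,v)\ge 4$ for all $u\in W_1,v\in W_2$, and let $\Delta^\psi$ be the flag handle addition obtained by removing the interior faces of $\operatorname{st}(\sigma_1,\Delta)$ and $\operatorname{st}(\sigma_2,\Delta)$ and identifying each $v\in W_1$ with $\psi(v)$. Then $$\gamma_2(\Delta^\psi)=\gamma_2(\Delta)+2\gamma_1(\operatorname{lk}(\sigma_1,\Delta))+16.$$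
   Context: A flag 3-manifold is a flag simplicial complex (all minimal non-faces have size 2) triangulating a closed 3-manifold. For a complex $\Gamma$, $f_i(\Gamma)$ is its number of $i$-faces. For a flag 3-manifold $\Delta$, $\gamma_2(\Delta)=f_1(\Delta)-5f_0(\Delta)+16$. For the link of an edge (a cycle), $\gamma_1(\operatorname{lk}(e))=f_0(\operatorname{lk}(e))-4$. $\operatorname{st}(\sigma,\Delta)=\{\tau\in\Delta:\sigma\cup\tau\in\Delta\}$, $\operatorname{lk}(\sigma,\Delta)=\{\tau\setminus\sigma:\sigma\subseteq\tau\in\Delta\}$; the star of an edge $e$ is the ball $\bar e*\operatorname{lk}(e)$, whose interior faces are those containing $e$, and $\operatorname{dist}$ is graph distance in $\Delta$. -}

module Defs where

open import Data.Bool using (Bool; true; false; T; not; _∧_; _∨_)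
open import Data.Nat using (ℕ; zero; suc; _≤_; _≡ᵇ_)
import Data.Nat as N
open import Data.Integer using (ℤ; +_; _-_; _+_; _*_)
open import Data.Fin using (Fin; _≟_)
open import Data.Fin.Subset using (Subset; ⁅_⁆; _∪_; _∩_; ∣_∣) renaming (⊥ to ∅)
open import Data.List using (List; []; _∷_; _++_; map; length; filterᵇ; allFin)
open import Data.Bool.ListAction using (any)
open import Data.Vec using (Vec; []; _∷_; lookup; tabulate)
open import Data.Product using (_×_; ∃; Σ)
open import Data.Sum using (_⊎_)
open import Relation.Binary.PropositionalEquality using (_≡_)
open import Relation.Nullary.Decidable using (⌊_⌋)

-- The vertices of K are the v : Fin n with {v} ∈ K (not every element
-- of Fin n has to be a vertex).

Cx : ℕ → Set
Cx n = Subset n → Bool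

_⊆ᵇ_ : ∀ {n} → Subset n → Subset n → Bool
[] ⊆ᵇ [] = true
(x ∷ xs) ⊆ᵇ (y ∷ ys) = (not x ∨ y) ∧ (xs ⊆ᵇ ys)

allSubsets : ∀ n → List (Subset n)
allSubsets zero = [] ∷ []
allSubsets (suc n) = map (false ∷_) s ++ map (true ∷_) s
  where s = allSubsets n

pair : ∀ {n} → Fin n → Fin n → Subset n
pair i j = ⁅ i ⁆ ∪ ⁅ j ⁆

IsComplex : ∀ {n} → Cx n → Set
IsComplex {n} K = T (K ∅) × (∀ σ τ → T (τ ⊆ᵇ σ) → T (K σ) → T (K τ))

isVertex : ∀ {n} → Cx n → Fin n → Bool
isVertex K v = K ⁅ v ⁆

vertexSet : ∀ {n} → Cx n → Subset n
vertexSet K = tabulate (isVertex K)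

f : ∀ {n} → Cx n → ℕ → ℕ
f {n} K k = length (filterᵇ (λ σ → K σ ∧ (∣ σ ∣ ≡ᵇ suc k)) (allSubsets n))

-- Flag: every set whose elements are pairwise adjacent (incl. vertices) is a face
IsFlag : ∀ {n} → Cx n → Set
IsFlag K = ∀ σ → (∀ i j → T (lookup σ i) → T (lookup σ j) → T (K (pair i j))) → T (K σ)

disjointᵇ : ∀ {n} → Subset n → Subset n → Bool
disjointᵇ σ τ = ∣ σ ∩ τ ∣ ≡ᵇ 0

lk : ∀ {n} → Subset n → Cx n → Cx n
lk σ K τ = K (σ ∪ τ) ∧ disjointᵇ σ τ

st : ∀ {n} → Subset n → Cx n → Cx n
st σ K τ = K (σ ∪ τ)

-- ∂st(σ,K): faces of the star not containing σ (interior faces = those containing σ)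
bst : ∀ {n} → Subset n → Cx n → Cx n
bst σ K τ = K (σ ∪ τ) ∧ not (σ ⊆ᵇ τ)

IsEdge : ∀ {n} → Cx n → Subset n → Set
IsEdge K e = T (K e) × ∣ e ∣ ≡ 2

image : ∀ {n m} → (Fin n → Fin m) → Subset n → Subset m
image {n} g σ = tabulate (λ w → any (λ v → lookup σ v ∧ ⌊ g v ≟ w ⌋) (allFin n))

data Walk {n} (K : Cx n) : Fin n → Fin n → ℕ → Set where
  here : ∀ {u} → Walk K u u 0
  step : ∀ {u v w k} → T (K (pair u v)) → Walk K v w k → Walk K u w (suc k)

Connected : ∀ {n} → Cx n → Set
Connected K = ∀ u v → T (isVertex K u) → T (isVertex K v) → ∃ λ k → Walk K u v k

NonEmpty : ∀ {n} → Cx n → Set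
NonEmpty K = ∃ λ v → T (isVertex K v)

degree : ∀ {n} → Cx n → Fin n → ℕ
degree {n} K v = length (filterᵇ (λ w → K (pair v w) ∧ not ⌊ v ≟ w ⌋) (allFin n))

IsCycle : ∀ {n} → Cx n → Set
IsCycle K = IsComplex K × (∀ σ → T (K σ) → ∣ σ ∣ ≤ 2)
          × (∀ v → T (isVertex K v) → degree K v ≡ 2) × Connected K × NonEmpty K

euler2 : ∀ {n} → Cx n → ℤ
euler2 K = (+ f K 0 - + f K 1) + + f K 2

IsS2 : ∀ {n} → Cx n → Set
IsS2 K = IsComplex K × (∀ σ → T (K σ) → ∣ σ ∣ ≤ 3)
       × (∀ v → T (isVertex K v) → IsCycle (lk ⁅ v ⁆ K))
       × Connected K × NonEmpty K × euler2 K ≡ + 2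

IsClosed3Manifold : ∀ {n} → Cx n → Set
IsClosed3Manifold K = IsComplex K × (∀ v → T (isVertex K v) → IsS2 (lk ⁅ v ⁆ K))

IsFlag3Manifold : ∀ {n} → Cx n → Set
IsFlag3Manifold K = IsFlag K × IsClosed3Manifold K

γ₂ : ∀ {n} → Cx n → ℤ
γ₂ K = (+ f K 1 - + (5 N.* f K 0)) + + 16

γ₁ : ∀ {n} → Cx n → ℤ
γ₁ K = + f K 0 - + 4

-- Simplicial isomorphism K → L given by a vertex map φ with inverse φ⁻
-- (both only relevant on the vertex sets).

_⇔_ : Set → Set → Set
A ⇔ B = (A → B) × (B → A)

IsSimpIso : ∀ {n₁ n₂} → Cx n₁ → Cx n₂ → (Fin n₁ → Fin n₂) → (Fin n₂ → Fin n₁) → Set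
IsSimpIso K L φ φ⁻ =
    (∀ v → T (isVertex K v) → T (isVertex L (φ v)) × φ⁻ (φ v) ≡ v)
  × (∀ w → T (isVertex L w) → T (isVertex K (φ⁻ w)) × φ (φ⁻ w) ≡ w)
  × (∀ σ → T (σ ⊆ᵇ vertexSet K) → K σ ≡ L (image φ σ))

-- Γ (on Fin m, with vertex maps π₁, π₂) is Δ₁ #_φ Δ₂: remove the interior
-- faces of st(e₁,Δ₁), st(e₂,Δ₂) and identify v ∈ V(∂st(e₁,Δ₁)) with φ v.

IsConnSum : ∀ {n₁ n₂ m} (Δ₁ : Cx n₁) (Δ₂ : Cx n₂) (e₁ : Subset n₁) (e₂ : Subset n₂)
            (φ : Fin n₁ → Fin n₂) (Γ : Cx m) (π₁ : Fin n₁ → Fin m) (π₂ : Fin n₂ → Fin m) → Set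
IsConnSum {n₁} {n₂} {m} Δ₁ Δ₂ e₁ e₂ φ Γ π₁ π₂ =
    (∀ v v' → π₁ v ≡ π₁ v' → v ≡ v')
  × (∀ w w' → π₂ w ≡ π₂ w' → w ≡ w')
  × (∀ v w → (π₁ v ≡ π₂ w) ⇔ (T (isVertex (bst e₁ Δ₁) v) × w ≡ φ v))
  × (∀ (u : Fin m) → (∃ λ v → π₁ v ≡ u) ⊎ (∃ λ w → π₂ w ≡ u))
  × (∀ ρ → T (Γ ρ) ⇔
       ((∃ λ σ → T (Δ₁ σ) × T (not (e₁ ⊆ᵇ σ)) × ρ ≡ image π₁ σ)
      ⊎ (∃ λ τ → T (Δ₂ τ) × T (not (e₂ ⊆ᵇ τ)) × ρ ≡ image π₂ τ)))

DistGe4 : ∀ {n} → Cx n → Subset n → Subset n → Set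
DistGe4 K W₁ W₂ = ∀ u v k → T (lookup W₁ u) → T (lookup W₂ v) → Walk K u v k → 4 ≤ k

-- Γ (on Fin m, with quotient vertex map π) is the handle addition Δ^ψ:
-- remove interior faces of st(σ₁,Δ), st(σ₂,Δ), identify v ∈ W₁ with ψ v.
IsHandleAdd : ∀ {n m} (Δ : Cx n) (σ₁ σ₂ : Subset n) (ψ : Fin n → Fin n)
              (Γ : Cx m) (π : Fin n → Fin m) → Set
IsHandleAdd {n} {m} Δ σ₁ σ₂ ψ Γ π =
    (∀ u v → (π u ≡ π v) ⇔
       (u ≡ v ⊎ (T (isVertex (st σ₁ Δ) u) × v ≡ ψ u) ⊎ (T (isVertex (st σ₁ Δ) v) × u ≡ ψ v)))
  × (∀ (x : Fin m) → ∃ λ u → π u ≡ x)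
  × (∀ ρ → T (Γ ρ) ⇔
       (∃ λ τ → T (Δ τ) × T (not (σ₁ ⊆ᵇ τ)) × T (not (σ₂ ⊆ᵇ τ)) × ρ ≡ image π τ))

-- Every face of the glued complex Γ is the image of a face that survives the removal of the open
-- stars, and images coincide only for the faces of ∂st(e₁) and ∂st(e₂) that are glued together:
-- a face of Δ₁ whose image meets Δ₂ has all its vertices in ∂st(e₁), hence lies in it by flagness,
-- and for a handle the distance ≥ 4 between the two stars rules out every other coincidence. So
-- f_k(Γ) + f_k(∂st e₁) counts the surviving faces. Removing the open star of an edge removes one
-- edge and no vertex, and ∂st(ab) = lk(ab) ∪ a * lk(ab) ∪ b * lk(ab) has ℓ + 2 vertices and 3ℓ
-- edges (ℓ = f₀(lk ab)), since lk(ab) = lk(b, lk(a)) is a cycle. Substituting these counts into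
-- γ₂ = f₁ − 5 f₀ + 16 gives both formulas.

module Submission where

open import Data.Bool using (Bool; true; false; T; not; _∧_)
open import Data.Bool.Properties using (T-∧; T-≡; T-not-≡)
open import Data.Empty using (⊥; ⊥-elim)
open import Data.Fin using (Fin; zero; suc; _≟_)
open import Data.Fin.Subset using (Subset; _∈_; _∉_; _⊆_; ⁅_⁆; _∪_; _∩_; ∣_∣; Empty; Nonempty)
  renaming (⊥ to ∅)
open import Data.Fin.Subset.Properties
  using (_∈?_; x∈p∪q⁺; x∈p∪q⁻; x∈⁅x⁆; x∈⁅y⁆⇒x≡y; x∈p∩q⁺; x∈p∩q⁻; p⊆p∪q; q⊆p∪q; ⊆-antisym; drop-∷-⊆;
         ∪-comm; ∪-assoc; ∪-idem; ∪-identityʳ; Empty-unique; nonempty?; ∉⊥; ∣⊥∣≡0; ∣⁅x⁆∣≡1;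
         p⊆q⇒∣p∣≤∣q∣; x∈p⇒∣p-x∣<∣p∣; p─q⊆p; x∈p∧x≢y⇒x∈p-y)
open import Data.List using (List; []; _∷_; _++_; map; length; filterᵇ; allFin)
import Data.List as List
open import Data.List.Properties using (length-++; length-map)
open import Data.List.Membership.Propositional using (lose) renaming (_∈_ to _∈ₗ_)
open import Data.List.Membership.Propositional.Properties
  using (∈-filter⁺; ∈-filter⁻; ∈-map⁺; ∈-map⁻; ∈-++⁺ˡ; ∈-++⁺ʳ; ∈-++⁻; ∈-allFin)
open import Data.List.Membership.Propositional.Properties.WithK using (unique∧set⇒bag)
open import Data.List.Relation.Binary.BagAndSetEquality using (∼bag⇒↭)
open import Data.List.Relation.Binary.Permutation.Propositional.Properties using (↭-length)
open import Data.List.Relation.Unary.All as All using (All; []; _∷_)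
import Data.List.Relation.Unary.All.Properties as All
open import Data.List.Relation.Unary.AllPairs using ([]; _∷_)
open import Data.List.Relation.Unary.Any using (here; there; satisfied)
open import Data.List.Relation.Unary.Any.Properties using (any⁺; any⁻)
open import Data.List.Relation.Unary.Unique.Propositional using (Unique)
import Data.List.Relation.Unary.Unique.Propositional.Properties as Unique
open import Data.Nat using (ℕ; zero; suc; _≤_; _<_; _≡ᵇ_; s≤s; z≤n)
import Data.Nat as ℕ
open import Data.Nat.Properties
  using (≡ᵇ⇒≡; ≡⇒≡ᵇ; suc-injective; n≮0; <-irrefl; ≤-<-trans; <⇒≱;
         +-identityʳ; +-assoc; +-comm; *-zeroʳ; *-suc; *-cancelˡ-≡)
open import Data.Product using (_×_; _,_; proj₁; proj₂; ∃; uncurry; map₁; map₂)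
open import Data.Product.Properties using (,-injective; ,-injectiveʳ)
open import Data.Sum using (_⊎_; inj₁; inj₂)
import Data.Sum as Sum
open import Data.Vec using (_∷_; []; lookup; tabulate)
import Data.Vec as Vec
open import Data.Vec.Properties using (∷-injectiveʳ; lookup∘tabulate; tabulate∘lookup; []=⇒lookup; lookup⇒[]=)
open import Function using (_∘_; id)
open import Function.Bundles using (Equivalence; mk⇔)
open import Relation.Nullary using (¬_; yes; no)
open import Relation.Nullary.Decidable using (T?; ⌊_⌋; toWitness; fromWitness)
open import Relation.Binary.PropositionalEquality

open import Defs

-- _⇔_ is the pair type of Defs; to and from are the projections of the library's equivalences (T-∧, T-≡).
open Equivalence using (to; from)

private
  variable
    n m : ℕ

-- The operators _+_, _*_ of ℕ and _-_ of subsets are opened only in this module: the statement of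
-- the theorem uses those of ℤ.
module _ where

  open import Data.Nat using (_+_; _*_)
  open import Data.Fin.Subset using (_-_)
  open import Data.Nat.Tactic.RingSolver using (solve-∀)

  T-not : ∀ {b} → T (not b) ⇔ (¬ T b)
  T-not {true} = (λ ()) , (λ ¬t → ¬t _)
  T-not {false} = (λ _ ()) , _

  unique∧set⇒length≡ : ∀ {A : Set} {xs ys : List A} → Unique xs → Unique ys →
                      (∀ {x} → (x ∈ₗ xs) ⇔ (x ∈ₗ ys)) → length xs ≡ length ys
  unique∧set⇒length≡ u v xs≈ys =
    ↭-length (∼bag⇒↭ (unique∧set⇒bag u v (mk⇔ (proj₁ xs≈ys) (proj₂ xs≈ys))))

  Unique-map⁺-on : ∀ {A B : Set} {xs : List A} (g : A → B) → Unique xs →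
                   (∀ {x y} → x ∈ₗ xs → y ∈ₗ xs → g x ≡ g y → x ≡ y) → Unique (map g xs)
  Unique-map⁺-on g [] inj = []
  Unique-map⁺-on g (x∉xs ∷ u) inj =
    All.map⁺ (All.tabulate λ y∈xs gx≡gy → All.lookup x∉xs y∈xs (inj (here refl) (there y∈xs) gx≡gy))
    ∷ Unique-map⁺-on g u (λ x∈ y∈ → inj (there x∈) (there y∈))

  -- Subsets of Fin n

  pair-comm : (x y : Fin n) → pair x y ≡ pair y x
  pair-comm x y = ∪-comm ⁅ x ⁆ ⁅ y ⁆

  ∈⇔T-lookup : ∀ (p : Subset n) {x} → (x ∈ p) ⇔ T (lookup p x)
  ∈⇔T-lookup p = (λ x∈p → from T-≡ ([]=⇒lookup x∈p)) , (λ t → lookup⇒[]= _ _ (to T-≡ t))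

  ⊆ᵇ⇔⊆ : ∀ {p q : Subset n} → T (p ⊆ᵇ q) ⇔ (p ⊆ q)
  ⊆ᵇ⇔⊆ = ⊆ᵇ⇒⊆ , ⊆⇒⊆ᵇ
    where
    ⊆ᵇ⇒⊆ : ∀ {n} {p q : Subset n} → T (p ⊆ᵇ q) → p ⊆ q
    ⊆ᵇ⇒⊆ {p = true ∷ p} {true ∷ q} h Vec.here = Vec.here
    ⊆ᵇ⇒⊆ {p = _ ∷ p} {_ ∷ q} h (Vec.there x∈p) = Vec.there (⊆ᵇ⇒⊆ (proj₂ (to T-∧ h)) x∈p)
    ⊆⇒⊆ᵇ : ∀ {n} {p q : Subset n} → p ⊆ q → T (p ⊆ᵇ q)
    ⊆⇒⊆ᵇ {p = []} {[]} _ = _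
    ⊆⇒⊆ᵇ {p = false ∷ p} {_ ∷ q} p⊆q = ⊆⇒⊆ᵇ (drop-∷-⊆ p⊆q)
    ⊆⇒⊆ᵇ {p = true ∷ p} {true ∷ q} p⊆q = ⊆⇒⊆ᵇ (drop-∷-⊆ p⊆q)
    ⊆⇒⊆ᵇ {p = true ∷ p} {false ∷ q} p⊆q with () ← p⊆q Vec.here

  T-not-⊆ᵇ : ∀ {p q : Subset n} → T (not (p ⊆ᵇ q)) ⇔ (¬ p ⊆ q)
  T-not-⊆ᵇ = (λ h → proj₁ T-not h ∘ proj₂ ⊆ᵇ⇔⊆) , (λ p⊈q → proj₂ T-not (p⊈q ∘ proj₁ ⊆ᵇ⇔⊆))

  ∣p∣≡0⇔Empty : ∀ {p : Subset n} → (∣ p ∣ ≡ 0) ⇔ Empty p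
  ∣p∣≡0⇔Empty {n} {p} =
    (λ { ∣p∣≡0 (x , x∈p) → n≮0 (subst (∣ p - x ∣ <_) ∣p∣≡0 (x∈p⇒∣p-x∣<∣p∣ x∈p)) }) ,
    (λ p-empty → trans (cong ∣_∣ (Empty-unique p-empty)) (∣⊥∣≡0 n))

  disjointᵇ⇔ : ∀ {p q : Subset n} → T (disjointᵇ p q) ⇔ (∀ {x} → x ∈ p → x ∉ q)
  disjointᵇ⇔ {p = p} {q} =
    (λ h x∈p x∈q → proj₁ ∣p∣≡0⇔Empty (≡ᵇ⇒≡ _ 0 h) (_ , x∈p∩q⁺ (x∈p , x∈q))) ,
    (λ h → ≡⇒≡ᵇ _ 0 (proj₂ ∣p∣≡0⇔Empty λ { (x , x∈p∩q) → uncurry h (x∈p∩q⁻ p q x∈p∩q) }))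

  ∣p∣≡suc⇒Nonempty : ∀ {p : Subset n} {k} → ∣ p ∣ ≡ suc k → Nonempty p
  ∣p∣≡suc⇒Nonempty {p = p} ∣p∣≡1+k with nonempty? p
  ... | yes ne = ne
  ... | no ¬ne with () ← trans (sym ∣p∣≡1+k) (proj₂ ∣p∣≡0⇔Empty ¬ne)

  x∉p-x : ∀ {x : Fin n} {p} → x ∉ p - x
  x∉p-x {x = zero} {_ ∷ _} ()
  x∉p-x {x = suc x} {_ ∷ _} (Vec.there x∈p-x) = x∉p-x x∈p-x

  ⁅x⁆∪[p-x]≡p : ∀ {x : Fin n} {p} → x ∈ p → ⁅ x ⁆ ∪ (p - x) ≡ p
  ⁅x⁆∪[p-x]≡p {x = x} {p} x∈p = ⊆-antisym ⊆p p⊆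
    where
    ⊆p : ⁅ x ⁆ ∪ (p - x) ⊆ p
    ⊆p y∈ with x∈p∪q⁻ ⁅ x ⁆ (p - x) y∈
    ... | inj₁ y∈⁅x⁆ = subst (_∈ p) (sym (x∈⁅y⁆⇒x≡y x y∈⁅x⁆)) x∈p
    ... | inj₂ y∈p-x = p─q⊆p p ⁅ x ⁆ y∈p-x
    p⊆ : p ⊆ ⁅ x ⁆ ∪ (p - x)
    p⊆ {y} y∈p with y ≟ x
    ... | yes refl = x∈p∪q⁺ (inj₁ (x∈⁅x⁆ x))
    ... | no y≢x = x∈p∪q⁺ (inj₂ (x∈p∧x≢y⇒x∈p-y y∈p y≢x))

  elements : Subset n → List (Fin n)
  elements {n} p = filterᵇ (lookup p) (allFin n)

  ∈-elements : ∀ (p : Subset n) {x} → (x ∈ₗ elements p) ⇔ (x ∈ p)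
  ∈-elements p {x} =
    (λ x∈ → proj₂ (∈⇔T-lookup p) (proj₂ (∈-filter⁻ (T? ∘ lookup p) {xs = allFin _} x∈))) ,
    (λ x∈p → ∈-filter⁺ (T? ∘ lookup p) (∈-allFin x) (proj₁ (∈⇔T-lookup p) x∈p))

  Unique-elements : (p : Subset n) → Unique (elements p)
  Unique-elements {n} p = Unique.filter⁺ (T? ∘ lookup p) (Unique.allFin⁺ n)

  ∣p∣≡length-elements : (p : Subset n) → ∣ p ∣ ≡ length (elements p)
  ∣p∣≡length-elements {n} p = sym (trans (length-filterᵇ-tabulate n id (lookup p)) (cong ∣_∣ (tabulate∘lookup p)))
    where
    length-filterᵇ-tabulate : ∀ {A : Set} n (h : Fin n → A) (b : A → Bool) →
                              length (filterᵇ b (List.tabulate h)) ≡ ∣ tabulate (b ∘ h) ∣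
    length-filterᵇ-tabulate zero h b = refl
    length-filterᵇ-tabulate (suc n) h b with b (h zero)
    ... | true = cong suc (length-filterᵇ-tabulate n (h ∘ suc) b)
    ... | false = length-filterᵇ-tabulate n (h ∘ suc) b

  ∣p∣-enumerated : ∀ {p : Subset n} {xs} → Unique xs → (∀ {x} → (x ∈ p) ⇔ (x ∈ₗ xs)) → ∣ p ∣ ≡ length xs
  ∣p∣-enumerated {p = p} u p≈xs =
    trans (∣p∣≡length-elements p)
          (unique∧set⇒length≡ (Unique-elements p) u
            ((λ x∈ → proj₁ p≈xs (proj₁ (∈-elements p) x∈)) , (λ x∈ → proj₂ (∈-elements p) (proj₂ p≈xs x∈))))

  ∣⁅x⁆∪p∣≡1+∣p∣ : ∀ {x : Fin n} {p} → x ∉ p → ∣ ⁅ x ⁆ ∪ p ∣ ≡ suc ∣ p ∣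
  ∣⁅x⁆∪p∣≡1+∣p∣ {x = x} {p} x∉p =
    trans (∣p∣-enumerated unique enumerates) (cong suc (sym (∣p∣≡length-elements p)))
    where
    unique : Unique (x ∷ elements p)
    unique = All.tabulate (λ y∈ x≡y → x∉p (proj₁ (∈-elements p) (subst (_∈ₗ elements p) (sym x≡y) y∈)))
             ∷ Unique-elements p
    enumerates : ∀ {y} → (y ∈ ⁅ x ⁆ ∪ p) ⇔ (y ∈ₗ x ∷ elements p)
    enumerates {y} = to∷ , from∷
      where
      to∷ : y ∈ ⁅ x ⁆ ∪ p → y ∈ₗ x ∷ elements p
      to∷ y∈ with x∈p∪q⁻ ⁅ x ⁆ p y∈
      ... | inj₁ y∈⁅x⁆ = here (x∈⁅y⁆⇒x≡y x y∈⁅x⁆)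
      ... | inj₂ y∈p = there (proj₂ (∈-elements p) y∈p)
      from∷ : y ∈ₗ x ∷ elements p → y ∈ ⁅ x ⁆ ∪ p
      from∷ (here refl) = x∈p∪q⁺ (inj₁ (x∈⁅x⁆ x))
      from∷ (there y∈) = x∈p∪q⁺ (inj₂ (proj₁ (∈-elements p) y∈))

  ∣pair∣≡2 : ∀ {x y : Fin n} → x ≢ y → ∣ pair x y ∣ ≡ 2
  ∣pair∣≡2 {x = x} {y} x≢y = trans (∣⁅x⁆∪p∣≡1+∣p∣ (x≢y ∘ x∈⁅y⁆⇒x≡y y)) (cong suc (∣⁅x⁆∣≡1 y))

  1+∣p-x∣≡∣p∣ : ∀ {x : Fin n} {p} → x ∈ p → suc ∣ p - x ∣ ≡ ∣ p ∣
  1+∣p-x∣≡∣p∣ {x = x} {p} x∈p =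
    trans (sym (∣⁅x⁆∪p∣≡1+∣p∣ {p = p - x} (x∉p-x {p = p}))) (cong ∣_∣ (⁅x⁆∪[p-x]≡p x∈p))

  ∣p∣≡0⇒p≡∅ : ∀ {p : Subset n} → ∣ p ∣ ≡ 0 → p ≡ ∅
  ∣p∣≡0⇒p≡∅ ∣p∣≡0 = Empty-unique (proj₁ ∣p∣≡0⇔Empty ∣p∣≡0)

  ∣p∣≡1⇒⁅x⁆ : ∀ {p : Subset n} → ∣ p ∣ ≡ 1 → ∃ λ x → p ≡ ⁅ x ⁆
  ∣p∣≡1⇒⁅x⁆ {p = p} ∣p∣≡1 with ∣p∣≡suc⇒Nonempty ∣p∣≡1
  ... | x , x∈p = x , (begin
    p                ≡⟨ ⁅x⁆∪[p-x]≡p x∈p ⟨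
    ⁅ x ⁆ ∪ (p - x)  ≡⟨ cong (⁅ x ⁆ ∪_) (∣p∣≡0⇒p≡∅ (suc-injective (trans (1+∣p-x∣≡∣p∣ x∈p) ∣p∣≡1))) ⟩
    ⁅ x ⁆ ∪ ∅        ≡⟨ ∪-identityʳ ⁅ x ⁆ ⟩
    ⁅ x ⁆            ∎)
    where open ≡-Reasoning

  ∣p∣≡2⇒pair : ∀ {p : Subset n} → ∣ p ∣ ≡ 2 → ∃ λ x → ∃ λ y → x ≢ y × p ≡ pair x y
  ∣p∣≡2⇒pair {p = p} ∣p∣≡2 with ∣p∣≡suc⇒Nonempty ∣p∣≡2
  ... | x , x∈p with ∣p∣≡1⇒⁅x⁆ (suc-injective (trans (1+∣p-x∣≡∣p∣ x∈p) ∣p∣≡2))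
  ... | y , p-x≡⁅y⁆ =
    x , y , (λ x≡y → x∉p-x (subst (_∈ p - x) (sym x≡y) (subst (y ∈_) (sym p-x≡⁅y⁆) (x∈⁅x⁆ y)))) ,
    trans (sym (⁅x⁆∪[p-x]≡p x∈p)) (cong (⁅ x ⁆ ∪_) p-x≡⁅y⁆)

  pair-elim : ∀ {ℓ} (P : Subset n → Set ℓ) → (∀ {x y} → x ≢ y → P (pair x y)) → ∀ {p} → ∣ p ∣ ≡ 2 → P p
  pair-elim P P-pair ∣p∣≡2 = elim (∣p∣≡2⇒pair ∣p∣≡2)
    where
    elim : ∀ {p} → (∃ λ x → ∃ λ y → x ≢ y × p ≡ pair x y) → P p
    elim (x , y , x≢y , refl) = P-pair x≢y

  ⊆∧∣∣≡⇒≡ : ∀ {p q : Subset n} → p ⊆ q → ∣ p ∣ ≡ ∣ q ∣ → p ≡ q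
  ⊆∧∣∣≡⇒≡ {p = p} {q} p⊆q ∣p∣≡∣q∣ = ⊆-antisym p⊆q q⊆p
    where
    q⊆p : q ⊆ p
    q⊆p {x} x∈q with x ∈? p
    ... | yes x∈p = x∈p
    ... | no x∉p = ⊥-elim (<-irrefl ∣p∣≡∣q∣ (≤-<-trans (p⊆q⇒∣p∣≤∣q∣ p⊆q-x) (x∈p⇒∣p-x∣<∣p∣ x∈q)))
      where
      p⊆q-x : p ⊆ q - x
      p⊆q-x y∈p = x∈p∧x≢y⇒x∈p-y (p⊆q y∈p) (λ { refl → x∉p y∈p })

  ∈-image⁻ : ∀ (g : Fin n → Fin m) σ {y} → y ∈ image g σ → ∃ λ x → x ∈ σ × g x ≡ y
  ∈-image⁻ {n} g σ {y} y∈
    with satisfied (any⁻ _ (allFin n) (subst T (lookup∘tabulate _ y) (proj₁ (∈⇔T-lookup (image g σ)) y∈)))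
  ... | x , t with to (T-∧ {lookup σ x}) t
  ...   | x∈σ , gx≡y = x , proj₂ (∈⇔T-lookup σ) x∈σ , toWitness {a? = g x ≟ y} gx≡y

  ∈-image⁺ : ∀ (g : Fin n → Fin m) {σ x} → x ∈ σ → g x ∈ image g σ
  ∈-image⁺ g {σ} {x} x∈σ =
    proj₂ (∈⇔T-lookup (image g σ)) (subst T (sym (lookup∘tabulate _ (g x)))
      (any⁺ _ (lose (∈-allFin x) (from T-∧ (proj₁ (∈⇔T-lookup σ) x∈σ , fromWitness refl)))))

  image-∘ : ∀ {k} (g : Fin m → Fin k) (h : Fin n → Fin m) σ → image g (image h σ) ≡ image (g ∘ h) σ
  image-∘ g h σ = ⊆-antisym ⊆∘ ∘⊆
    where
    ⊆∘ : image g (image h σ) ⊆ image (g ∘ h) σ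
    ⊆∘ z∈ with ∈-image⁻ g (image h σ) z∈
    ... | y , y∈ , refl with ∈-image⁻ h σ y∈
    ... | x , x∈σ , refl = ∈-image⁺ (g ∘ h) x∈σ
    ∘⊆ : image (g ∘ h) σ ⊆ image g (image h σ)
    ∘⊆ z∈ with ∈-image⁻ (g ∘ h) σ z∈
    ... | x , x∈σ , refl = ∈-image⁺ g (∈-image⁺ h x∈σ)

  image-cong : ∀ {g h : Fin n → Fin m} {σ} → (∀ {x} → x ∈ σ → g x ≡ h x) → image g σ ≡ image h σ
  image-cong {g = g} {h} {σ} g≗h = ⊆-antisym (⊆image g h g≗h) (⊆image h g (sym ∘ g≗h))
    where
    ⊆image : ∀ g h → (∀ {x} → x ∈ σ → g x ≡ h x) → image g σ ⊆ image h σ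
    ⊆image g h g≗h y∈ with ∈-image⁻ g σ y∈
    ... | x , x∈σ , refl = subst (_∈ image h σ) (sym (g≗h x∈σ)) (∈-image⁺ h x∈σ)

  ∣image∣ : ∀ (g : Fin n → Fin m) {σ} → (∀ {x y} → x ∈ σ → y ∈ σ → g x ≡ g y → x ≡ y) →
            ∣ image g σ ∣ ≡ ∣ σ ∣
  ∣image∣ g {σ} injective =
    trans (∣p∣-enumerated unique enumerates) (trans (length-map g (elements σ)) (sym (∣p∣≡length-elements σ)))
    where
    unique : Unique (map g (elements σ))
    unique = Unique-map⁺-on g (Unique-elements σ)
      (λ x∈ y∈ → injective (proj₁ (∈-elements σ) x∈) (proj₁ (∈-elements σ) y∈))
    enumerates : ∀ {y} → (y ∈ image g σ) ⇔ (y ∈ₗ map g (elements σ))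
    enumerates = (λ y∈ → let (x , x∈σ , gx≡y) = ∈-image⁻ g σ y∈ in
                          subst (_∈ₗ _) gx≡y (∈-map⁺ g (proj₂ (∈-elements σ) x∈σ))) ,
                 (λ y∈ → let (x , x∈ , y≡gx) = ∈-map⁻ g y∈ in
                          subst (_∈ image g σ) (sym y≡gx) (∈-image⁺ g (proj₁ (∈-elements σ) x∈)))

  image-injective : ∀ (g : Fin n → Fin m) → (∀ {x y} → g x ≡ g y → x ≡ y) →
                    ∀ {σ τ} → image g σ ≡ image g τ → σ ≡ τ
  image-injective g injective {σ} {τ} eq = ⊆-antisym (⊆-from eq) (⊆-from (sym eq))
    where
    ⊆-from : ∀ {σ τ} → image g σ ≡ image g τ → σ ⊆ τ
    ⊆-from {σ} {τ} eq x∈σ with ∈-image⁻ g τ (subst (g _ ∈_) eq (∈-image⁺ g x∈σ))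
    ... | y , y∈τ , gy≡gx = subst (_∈ τ) (injective gy≡gx) y∈τ

  -- Counting faces

  ∈-allSubsets : (σ : Subset n) → σ ∈ₗ allSubsets n
  ∈-allSubsets [] = here refl
  ∈-allSubsets {suc n} (false ∷ σ) = ∈-++⁺ˡ (∈-map⁺ (false ∷_) (∈-allSubsets σ))
  ∈-allSubsets {suc n} (true ∷ σ) = ∈-++⁺ʳ (map (false ∷_) (allSubsets n)) (∈-map⁺ (true ∷_) (∈-allSubsets σ))

  Unique-allSubsets : ∀ n → Unique (allSubsets n)
  Unique-allSubsets zero = [] ∷ []
  Unique-allSubsets (suc n) =
    Unique.++⁺ (Unique.map⁺ ∷-injectiveʳ (Unique-allSubsets n)) (Unique.map⁺ ∷-injectiveʳ (Unique-allSubsets n))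
      λ { (σ∈ , τ∈) → false≢true (∈-map-head σ∈ τ∈) }
    where
    ∈-map-head : ∀ {σ} {b c : Bool} → σ ∈ₗ map (b ∷_) (allSubsets n) → σ ∈ₗ map (c ∷_) (allSubsets n) → b ≡ c
    ∈-map-head σ∈ τ∈ with ∈-map⁻ _ σ∈ | ∈-map⁻ _ τ∈
    ... | _ , _ , refl | _ , _ , refl = refl
    false≢true : false ≢ true
    false≢true ()

  -- j counts vertices, not dimension: f K k is nFaces K (suc k).
  Face : Cx n → ℕ → Subset n → Set
  Face K j σ = T (K σ) × ∣ σ ∣ ≡ j

  faces : Cx n → ℕ → List (Subset n)
  faces {n} K j = filterᵇ (λ σ → K σ ∧ (∣ σ ∣ ≡ᵇ j)) (allSubsets n)

  nFaces : Cx n → ℕ → ℕ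
  nFaces K j = length (faces K j)

  ∈-faces : ∀ (K : Cx n) j {σ} → (σ ∈ₗ faces K j) ⇔ Face K j σ
  ∈-faces {n} K j {σ} =
    (λ σ∈ → map₂ (≡ᵇ⇒≡ _ j) (to T-∧ (proj₂ (∈-filter⁻ (T? ∘ _) {xs = allSubsets n} σ∈)))) ,
    (λ { (Kσ , ∣σ∣≡j) → ∈-filter⁺ (T? ∘ _) (∈-allSubsets σ) (from T-∧ (Kσ , ≡⇒≡ᵇ _ j ∣σ∣≡j)) })

  Unique-faces : ∀ (K : Cx n) j → Unique (faces K j)
  Unique-faces {n} K j = Unique.filter⁺ (T? ∘ _) (Unique-allSubsets n)

  nFaces-enumerated : ∀ (K : Cx n) j {L} → Unique L → (∀ {σ} → (σ ∈ₗ L) ⇔ Face K j σ) → nFaces K j ≡ length L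
  nFaces-enumerated K j u L≈K =
    unique∧set⇒length≡ (Unique-faces K j) u
      ((λ σ∈ → proj₂ L≈K (proj₁ (∈-faces K j) σ∈)) , (λ σ∈ → proj₂ (∈-faces K j) (proj₁ L≈K σ∈)))

  nFaces-cong : ∀ (K L : Cx n) j → (∀ {σ} → ∣ σ ∣ ≡ j → T (K σ) ⇔ T (L σ)) → nFaces K j ≡ nFaces L j
  nFaces-cong K L j K≈L = nFaces-enumerated K j (Unique-faces L j)
    ((λ σ∈ → let (Lσ , ∣σ∣≡j) = proj₁ (∈-faces L j) σ∈ in proj₂ (K≈L ∣σ∣≡j) Lσ , ∣σ∣≡j) ,
     (λ { (Kσ , ∣σ∣≡j) → proj₂ (∈-faces L j) (proj₁ (K≈L ∣σ∣≡j) Kσ , ∣σ∣≡j) }))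

  _∖_ : Cx n → Cx n → Cx n
  (K ∖ L) σ = K σ ∧ not (L σ)

  nFaces-∖ : ∀ (K L : Cx n) j → (∀ {σ} → T (L σ) → T (K σ)) → nFaces K j ≡ nFaces L j + nFaces (K ∖ L) j
  nFaces-∖ K L j L⊆K =
    trans (nFaces-enumerated K j unique enumerates) (length-++ (faces L j))
    where
    unique : Unique (faces L j ++ faces (K ∖ L) j)
    unique = Unique.++⁺ (Unique-faces L j) (Unique-faces (K ∖ L) j) λ { (σ∈L , σ∈K∖L) →
      proj₁ T-not (proj₂ (to T-∧ (proj₁ (proj₁ (∈-faces (K ∖ L) j) σ∈K∖L)))) (proj₁ (proj₁ (∈-faces L j) σ∈L)) }
    enumerates : ∀ {σ} → (σ ∈ₗ faces L j ++ faces (K ∖ L) j) ⇔ Face K j σ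
    enumerates {σ} = to++ , from++
      where
      to++ : σ ∈ₗ faces L j ++ faces (K ∖ L) j → Face K j σ
      to++ σ∈ with ∈-++⁻ (faces L j) σ∈
      ... | inj₁ σ∈L = map₁ L⊆K (proj₁ (∈-faces L j) σ∈L)
      ... | inj₂ σ∈K∖L = map₁ (proj₁ ∘ to T-∧) (proj₁ (∈-faces (K ∖ L) j) σ∈K∖L)
      from++ : Face K j σ → σ ∈ₗ faces L j ++ faces (K ∖ L) j
      from++ (Kσ , ∣σ∣≡j) with L σ in Lσ≡
      ... | true = ∈-++⁺ˡ (proj₂ (∈-faces L j) (from T-≡ Lσ≡ , ∣σ∣≡j))
      ... | false = ∈-++⁺ʳ (faces L j) (proj₂ (∈-faces (K ∖ L) j) (from T-∧ (Kσ , from T-not-≡ Lσ≡) , ∣σ∣≡j))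

  nFaces-image₂ : ∀ {n₁ n₂} (K₁ : Cx n₁) (K₂ : Cx n₂) (L : Cx m) j
                  (g₁ : Subset n₁ → Subset m) (g₂ : Subset n₂ → Subset m) →
                  (∀ {σ τ} → Face K₁ j σ → Face K₁ j τ → g₁ σ ≡ g₁ τ → σ ≡ τ) →
                  (∀ {σ τ} → Face K₂ j σ → Face K₂ j τ → g₂ σ ≡ g₂ τ → σ ≡ τ) →
                  (∀ {σ τ} → Face K₁ j σ → Face K₂ j τ → g₁ σ ≢ g₂ τ) →
                  (∀ {ρ} → Face L j ρ ⇔ ((∃ λ σ → Face K₁ j σ × g₁ σ ≡ ρ) ⊎ (∃ λ τ → Face K₂ j τ × g₂ τ ≡ ρ))) →
                  nFaces L j ≡ nFaces K₁ j + nFaces K₂ j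
  nFaces-image₂ K₁ K₂ L j g₁ g₂ injective₁ injective₂ disjoint L≈images = begin
    nFaces L j                                                   ≡⟨ nFaces-enumerated L j unique enumerates ⟩
    length (map g₁ (faces K₁ j) ++ map g₂ (faces K₂ j))          ≡⟨ length-++ (map g₁ (faces K₁ j)) ⟩
    length (map g₁ (faces K₁ j)) + length (map g₂ (faces K₂ j))
      ≡⟨ cong₂ _+_ (length-map g₁ (faces K₁ j)) (length-map g₂ (faces K₂ j)) ⟩
    nFaces K₁ j + nFaces K₂ j                                    ∎
    where
    open ≡-Reasoning
    face₁ : ∀ {σ} → σ ∈ₗ faces K₁ j → Face K₁ j σ
    face₁ = proj₁ (∈-faces K₁ j)
    face₂ : ∀ {τ} → τ ∈ₗ faces K₂ j → Face K₂ j τ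
    face₂ = proj₁ (∈-faces K₂ j)
    unique : Unique (map g₁ (faces K₁ j) ++ map g₂ (faces K₂ j))
    unique = Unique.++⁺
      (Unique-map⁺-on g₁ (Unique-faces K₁ j) (λ σ∈ τ∈ → injective₁ (face₁ σ∈) (face₁ τ∈)))
      (Unique-map⁺-on g₂ (Unique-faces K₂ j) (λ σ∈ τ∈ → injective₂ (face₂ σ∈) (face₂ τ∈)))
      λ { (ρ∈₁ , ρ∈₂) → let (σ , σ∈ , ρ≡g₁σ) = ∈-map⁻ g₁ ρ∈₁ ; (τ , τ∈ , ρ≡g₂τ) = ∈-map⁻ g₂ ρ∈₂ in
                        disjoint (face₁ σ∈) (face₂ τ∈) (trans (sym ρ≡g₁σ) ρ≡g₂τ) }
    enumerates : ∀ {ρ} → (ρ ∈ₗ map g₁ (faces K₁ j) ++ map g₂ (faces K₂ j)) ⇔ Face L j ρ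
    enumerates {ρ} = to++ , from++
      where
      to++ : ρ ∈ₗ map g₁ (faces K₁ j) ++ map g₂ (faces K₂ j) → Face L j ρ
      to++ ρ∈ with ∈-++⁻ (map g₁ (faces K₁ j)) ρ∈
      ... | inj₁ ρ∈₁ = let (σ , σ∈ , ρ≡g₁σ) = ∈-map⁻ g₁ ρ∈₁ in proj₂ L≈images (inj₁ (σ , face₁ σ∈ , sym ρ≡g₁σ))
      ... | inj₂ ρ∈₂ = let (τ , τ∈ , ρ≡g₂τ) = ∈-map⁻ g₂ ρ∈₂ in proj₂ L≈images (inj₂ (τ , face₂ τ∈ , sym ρ≡g₂τ))
      from++ : Face L j ρ → ρ ∈ₗ map g₁ (faces K₁ j) ++ map g₂ (faces K₂ j)
      from++ Lρ with proj₁ L≈images Lρ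
      ... | inj₁ (σ , K₁σ , refl) = ∈-++⁺ˡ (∈-map⁺ g₁ (proj₂ (∈-faces K₁ j) K₁σ))
      ... | inj₂ (τ , K₂τ , refl) = ∈-++⁺ʳ (map g₁ (faces K₁ j)) (∈-map⁺ g₂ (proj₂ (∈-faces K₂ j) K₂τ))

  nFaces-image : ∀ (K : Cx n) (L : Cx m) j (g : Subset n → Subset m) →
                 (∀ {σ τ} → Face K j σ → Face K j τ → g σ ≡ g τ → σ ≡ τ) →
                 (∀ {ρ} → Face L j ρ ⇔ (∃ λ σ → Face K j σ × g σ ≡ ρ)) →
                 nFaces L j ≡ nFaces K j
  nFaces-image {n} K L j g injective L≈image =
    trans (nFaces-image₂ {n₂ = n} K (λ _ → false) L j g g injective (λ ()) (λ _ ())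
            ((inj₁ ∘ proj₁ L≈image) , λ { (inj₁ σ) → proj₂ L≈image σ }))
          (trans (cong (nFaces K j +_) (nFaces-enumerated {n} (λ _ → false) j [] ((λ ()) , λ ()))) (+-identityʳ _))

  -- Links, stars and deletions

  face-⊆ : ∀ {K : Cx n} → IsComplex K → ∀ {σ τ} → τ ⊆ σ → T (K σ) → T (K τ)
  face-⊆ (_ , down-closed) τ⊆σ Kσ = down-closed _ _ (proj₂ ⊆ᵇ⇔⊆ τ⊆σ) Kσ

  ∣∣<⇒⊈ : ∀ {σ τ : Subset n} → ∣ τ ∣ < ∣ σ ∣ → ¬ σ ⊆ τ
  ∣∣<⇒⊈ ∣τ∣<∣σ∣ σ⊆τ = <⇒≱ ∣τ∣<∣σ∣ (p⊆q⇒∣p∣≤∣q∣ σ⊆τ)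

  pair⊆ : ∀ {x y : Fin n} {σ} → x ∈ σ → y ∈ σ → pair x y ⊆ σ
  pair⊆ {x = x} {y} x∈σ y∈σ z∈ with x∈p∪q⁻ ⁅ x ⁆ ⁅ y ⁆ z∈
  ... | inj₁ z∈⁅x⁆ = subst (_∈ _) (sym (x∈⁅y⁆⇒x≡y x z∈⁅x⁆)) x∈σ
  ... | inj₂ z∈⁅y⁆ = subst (_∈ _) (sym (x∈⁅y⁆⇒x≡y y z∈⁅y⁆)) y∈σ

  ∈-pair⁻ : ∀ {x y z : Fin n} → z ∈ pair x y → z ≡ x ⊎ z ≡ y
  ∈-pair⁻ {x = x} {y} z∈ with x∈p∪q⁻ ⁅ x ⁆ ⁅ y ⁆ z∈
  ... | inj₁ z∈⁅x⁆ = inj₁ (x∈⁅y⁆⇒x≡y x z∈⁅x⁆)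
  ... | inj₂ z∈⁅y⁆ = inj₂ (x∈⁅y⁆⇒x≡y y z∈⁅y⁆)

  x∈pair : ∀ (x y : Fin n) → x ∈ pair x y
  x∈pair x y = x∈p∪q⁺ (inj₁ (x∈⁅x⁆ x))

  y∈pair : ∀ (x y : Fin n) → y ∈ pair x y
  y∈pair x y = x∈p∪q⁺ (inj₂ (x∈⁅x⁆ y))

  T-bst : ∀ e (K : Cx n) {σ} → T (bst e K σ) ⇔ (T (K (e ∪ σ)) × ¬ e ⊆ σ)
  T-bst e K = map₂ (proj₁ T-not-⊆ᵇ) ∘ to T-∧ , from T-∧ ∘ map₂ (proj₂ T-not-⊆ᵇ)

  T-lk : ∀ e (K : Cx n) {σ} → T (lk e K σ) ⇔ (T (K (e ∪ σ)) × (∀ {x} → x ∈ e → x ∉ σ))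
  T-lk e K = map₂ (proj₁ disjointᵇ⇔) ∘ to T-∧ , from T-∧ ∘ map₂ (proj₂ disjointᵇ⇔)

  del : Subset n → Cx n → Cx n
  del e K σ = K σ ∧ not (e ⊆ᵇ σ)

  T-del : ∀ e (K : Cx n) {σ} → T (del e K σ) ⇔ (T (K σ) × ¬ e ⊆ σ)
  T-del e K = map₂ (proj₁ T-not-⊆ᵇ) ∘ to T-∧ , from T-∧ ∘ map₂ (proj₂ T-not-⊆ᵇ)

  bst⊆del : ∀ {e} {K : Cx n} → IsComplex K → ∀ {σ} → T (bst e K σ) → T (del e K σ)
  bst⊆del {e = e} {K} cx bstσ = let (K[e∪σ] , e⊈σ) = proj₁ (T-bst e K) bstσ in
    proj₂ (T-del e K) (face-⊆ cx (q⊆p∪q _ _) K[e∪σ] , e⊈σ)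

  flag-star-closed : ∀ {K : Cx n} → IsComplex K → IsFlag K → ∀ {e σ} → T (K e) → T (K σ) →
                     (∀ {v} → v ∈ σ → T (K (e ∪ ⁅ v ⁆))) → T (K (e ∪ σ))
  flag-star-closed {K = K} cx flag {e} {σ} Ke Kσ vertices-in-star =
    flag (e ∪ σ) λ i j i∈ j∈ → edge (proj₂ (∈⇔T-lookup (e ∪ σ)) i∈) (proj₂ (∈⇔T-lookup (e ∪ σ)) j∈)
    where
    edge : ∀ {i j} → i ∈ e ∪ σ → j ∈ e ∪ σ → T (K (pair i j))
    edge {i} {j} i∈ j∈ with x∈p∪q⁻ e σ i∈ | x∈p∪q⁻ e σ j∈
    ... | inj₁ i∈e | inj₁ j∈e = face-⊆ cx (pair⊆ i∈e j∈e) Ke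
    ... | inj₁ i∈e | inj₂ j∈σ = face-⊆ cx (pair⊆ (x∈p∪q⁺ (inj₁ i∈e)) (x∈p∪q⁺ (inj₂ (x∈⁅x⁆ j)))) (vertices-in-star j∈σ)
    ... | inj₂ i∈σ | inj₁ j∈e = face-⊆ cx (pair⊆ (x∈p∪q⁺ (inj₂ (x∈⁅x⁆ i))) (x∈p∪q⁺ (inj₁ j∈e))) (vertices-in-star i∈σ)
    ... | inj₂ i∈σ | inj₂ j∈σ = face-⊆ cx (pair⊆ i∈σ j∈σ) Kσ

  -- The boundary of the star of an edge

  ∪-absorbs : ∀ {e : Subset n} {x p} → x ∈ e → e ∪ (⁅ x ⁆ ∪ p) ≡ e ∪ p
  ∪-absorbs {e = e} {x} {p} x∈e = ⊆-antisym ⊆e∪p e∪p⊆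
    where
    ⊆e∪p : e ∪ (⁅ x ⁆ ∪ p) ⊆ e ∪ p
    ⊆e∪p z∈ with x∈p∪q⁻ e _ z∈
    ... | inj₁ z∈e = x∈p∪q⁺ (inj₁ z∈e)
    ... | inj₂ z∈⁅x⁆∪p with x∈p∪q⁻ ⁅ x ⁆ p z∈⁅x⁆∪p
    ...   | inj₁ z∈⁅x⁆ = x∈p∪q⁺ (inj₁ (subst (_∈ e) (sym (x∈⁅y⁆⇒x≡y x z∈⁅x⁆)) x∈e))
    ...   | inj₂ z∈p = x∈p∪q⁺ (inj₂ z∈p)
    e∪p⊆ : e ∪ p ⊆ e ∪ (⁅ x ⁆ ∪ p)
    e∪p⊆ z∈ with x∈p∪q⁻ e p z∈
    ... | inj₁ z∈e = x∈p∪q⁺ (inj₁ z∈e)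
    ... | inj₂ z∈p = x∈p∪q⁺ (inj₂ (x∈p∪q⁺ (inj₂ z∈p)))

  [⁅x⁆∪p]-x≡p : ∀ {x : Fin n} {p} → x ∉ p → (⁅ x ⁆ ∪ p) - x ≡ p
  [⁅x⁆∪p]-x≡p {x = x} {p} x∉p = ⊆-antisym ⊆p p⊆
    where
    ⊆p : (⁅ x ⁆ ∪ p) - x ⊆ p
    ⊆p {z} z∈ with x∈p∪q⁻ ⁅ x ⁆ p (p─q⊆p _ ⁅ x ⁆ z∈)
    ... | inj₁ z∈⁅x⁆ = ⊥-elim (x∉p-x (subst (_∈ _) (x∈⁅y⁆⇒x≡y x z∈⁅x⁆) z∈))
    ... | inj₂ z∈p = z∈p
    p⊆ : p ⊆ (⁅ x ⁆ ∪ p) - x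
    p⊆ z∈p = x∈p∧x≢y⇒x∈p-y (x∈p∪q⁺ (inj₂ z∈p)) (λ { refl → x∉p z∈p })

  -- Faces of ∂st(e) through the endpoint x of e = {x, y} are the cones x * ρ over faces ρ of lk(e).
  module Cone (K : Cx n) {e : Subset n} {x y : Fin n} (x≢y : x ≢ y) (x∈e : x ∈ e) (y∈e : y ∈ e)
              (e⊆xy : ∀ {z} → z ∈ e → z ≡ x ⊎ z ≡ y) where

    cone : ∀ {j ρ} → Face (lk e K) j ρ → Face (bst e K) (suc j) (⁅ x ⁆ ∪ ρ)
    cone {ρ = ρ} (lkρ , ∣ρ∣≡j) =
      proj₂ (T-bst e K) (subst (T ∘ K) (sym (∪-absorbs x∈e)) K[e∪ρ] , λ e⊆ → y∉ (e⊆ y∈e)) ,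
      trans (∣⁅x⁆∪p∣≡1+∣p∣ (disjoint x∈e)) (cong suc ∣ρ∣≡j)
      where
      K[e∪ρ] : T (K (e ∪ ρ))
      K[e∪ρ] = proj₁ (proj₁ (T-lk e K) lkρ)
      disjoint : ∀ {z} → z ∈ e → z ∉ ρ
      disjoint = proj₂ (proj₁ (T-lk e K) lkρ)
      y∉ : y ∉ ⁅ x ⁆ ∪ ρ
      y∉ y∈ with x∈p∪q⁻ ⁅ x ⁆ ρ y∈
      ... | inj₁ y∈⁅x⁆ = x≢y (sym (x∈⁅y⁆⇒x≡y x y∈⁅x⁆))
      ... | inj₂ y∈ρ = disjoint y∈e y∈ρ

    uncone : ∀ {j σ} → Face (bst e K) (suc j) σ → x ∈ σ → Face (lk e K) j (σ - x)
    uncone {σ = σ} (bstσ , ∣σ∣≡1+j) x∈σ =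
      proj₂ (T-lk e K) (subst (T ∘ K) e∪σ≡ K[e∪σ] , disjoint) ,
      suc-injective (trans (1+∣p-x∣≡∣p∣ x∈σ) ∣σ∣≡1+j)
      where
      K[e∪σ] : T (K (e ∪ σ))
      K[e∪σ] = proj₁ (proj₁ (T-bst e K) bstσ)
      e⊈σ : ¬ e ⊆ σ
      e⊈σ = proj₂ (proj₁ (T-bst e K) bstσ)
      e∪σ≡ : e ∪ σ ≡ e ∪ (σ - x)
      e∪σ≡ = trans (cong (e ∪_) (sym (⁅x⁆∪[p-x]≡p x∈σ))) (∪-absorbs x∈e)
      disjoint : ∀ {z} → z ∈ e → z ∉ σ - x
      disjoint z∈e z∈σ-x with e⊆xy z∈e
      ... | inj₁ refl = x∉p-x z∈σ-x
      ... | inj₂ refl = e⊈σ λ w∈e → endpoint∈σ (e⊆xy w∈e)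
        where
        endpoint∈σ : ∀ {w} → w ≡ x ⊎ w ≡ y → w ∈ σ
        endpoint∈σ (inj₁ refl) = x∈σ
        endpoint∈σ (inj₂ refl) = p─q⊆p σ _ z∈σ-x

    cone-injective : ∀ {j ρ ρ′} → Face (lk e K) j ρ → Face (lk e K) j ρ′ → ⁅ x ⁆ ∪ ρ ≡ ⁅ x ⁆ ∪ ρ′ → ρ ≡ ρ′
    cone-injective (lkρ , _) (lkρ′ , _) eq =
      trans (sym ([⁅x⁆∪p]-x≡p (x∉ lkρ))) (trans (cong (_- x) eq) ([⁅x⁆∪p]-x≡p (x∉ lkρ′)))
      where
      x∉ : ∀ {ρ} → T (lk e K ρ) → x ∉ ρ
      x∉ lkρ = proj₂ (proj₁ (T-lk e K) lkρ) x∈e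

  -- ∂st(ab) is lk(ab) together with the two cones a * lk(ab) and b * lk(ab).
  module EdgeStar (K : Cx n) {a b : Fin n} (a≢b : a ≢ b) (j : ℕ) where

    e : Subset n
    e = pair a b

    links : ℕ → List (Subset n)
    links = faces (lk e K)

    cones : Fin n → List (Subset n)
    cones x = map (⁅ x ⁆ ∪_) (links j)

    private
      module A = Cone K a≢b (x∈pair a b) (y∈pair a b) ∈-pair⁻
      module B = Cone K (a≢b ∘ sym) (y∈pair a b) (x∈pair a b) (Sum.swap ∘ ∈-pair⁻)

      link-face : ∀ {i ρ} → ρ ∈ₗ links i → Face (lk e K) i ρ
      link-face = proj₁ (∈-faces (lk e K) _)

      ∉link-face : ∀ {i ρ x} → ρ ∈ₗ links i → x ∈ e → x ∉ ρ
      ∉link-face ρ∈ = proj₂ (proj₁ (T-lk e K) (proj₁ (link-face ρ∈)))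

      apex∈ : ∀ {x σ} → σ ∈ₗ cones x → x ∈ σ
      apex∈ {x} σ∈ with ∈-map⁻ (⁅ x ⁆ ∪_) σ∈
      ... | _ , _ , refl = x∈p∪q⁺ (inj₁ (x∈⁅x⁆ x))

    Unique-links++cones : Unique (links (suc j) ++ (cones a ++ cones b))
    Unique-links++cones = Unique.++⁺ (Unique-faces (lk e K) (suc j))
      (Unique.++⁺ (Unique-map⁺-on _ (Unique-faces _ j) λ ρ∈ ρ′∈ → A.cone-injective (link-face ρ∈) (link-face ρ′∈))
                  (Unique-map⁺-on _ (Unique-faces _ j) λ ρ∈ ρ′∈ → B.cone-injective (link-face ρ∈) (link-face ρ′∈))
                  λ { (σ∈a , σ∈b) → b∉a-cone σ∈a (apex∈ σ∈b) })
      λ { (σ∈link , σ∈cones) → apex∉link σ∈link (∈-++⁻ (cones a) σ∈cones) }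
      where
      b∉a-cone : ∀ {σ} → σ ∈ₗ cones a → b ∉ σ
      b∉a-cone σ∈ b∈ with ∈-map⁻ (⁅ a ⁆ ∪_) σ∈
      ... | ρ , ρ∈ , refl with x∈p∪q⁻ ⁅ a ⁆ ρ b∈
      ...   | inj₁ b∈⁅a⁆ = a≢b (sym (x∈⁅y⁆⇒x≡y a b∈⁅a⁆))
      ...   | inj₂ b∈ρ = ∉link-face ρ∈ (y∈pair a b) b∈ρ
      apex∉link : ∀ {σ} → σ ∈ₗ links (suc j) → σ ∈ₗ cones a ⊎ σ ∈ₗ cones b → ⊥
      apex∉link σ∈ (inj₁ σ∈a) = ∉link-face σ∈ (x∈pair a b) (apex∈ σ∈a)
      apex∉link σ∈ (inj₂ σ∈b) = ∉link-face σ∈ (y∈pair a b) (apex∈ σ∈b)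

    ∈-links++cones : ∀ {σ} → (σ ∈ₗ links (suc j) ++ (cones a ++ cones b)) ⇔ Face (bst e K) (suc j) σ
    ∈-links++cones {σ} = to-bst , from-bst
      where
      cone-face : ∀ {x} → (∀ {ρ} → Face (lk e K) j ρ → Face (bst e K) (suc j) (⁅ x ⁆ ∪ ρ)) →
                  σ ∈ₗ cones x → Face (bst e K) (suc j) σ
      cone-face {x} cone σ∈ with ∈-map⁻ (⁅ x ⁆ ∪_) σ∈
      ... | ρ , ρ∈ , refl = cone (link-face ρ∈)
      to-bst : σ ∈ₗ links (suc j) ++ (cones a ++ cones b) → Face (bst e K) (suc j) σ
      to-bst σ∈ with ∈-++⁻ (links (suc j)) σ∈
      ... | inj₁ σ∈link = let (K[e∪σ] , _) = proj₁ (T-lk e K) (proj₁ (link-face σ∈link)) in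
        proj₂ (T-bst e K) (K[e∪σ] , λ e⊆σ → ∉link-face σ∈link (x∈pair a b) (e⊆σ (x∈pair a b))) ,
        proj₂ (link-face σ∈link)
      ... | inj₂ σ∈cones with ∈-++⁻ (cones a) σ∈cones
      ...   | inj₁ σ∈a = cone-face A.cone σ∈a
      ...   | inj₂ σ∈b = cone-face B.cone σ∈b
      from-bst : Face (bst e K) (suc j) σ → σ ∈ₗ links (suc j) ++ (cones a ++ cones b)
      from-bst bstσ with a ∈? σ | b ∈? σ
      ... | yes a∈σ | _ = ∈-++⁺ʳ (links (suc j)) (∈-++⁺ˡ (subst (_∈ₗ cones a) (⁅x⁆∪[p-x]≡p a∈σ)
                            (∈-map⁺ (⁅ a ⁆ ∪_) (proj₂ (∈-faces (lk e K) j) (A.uncone bstσ a∈σ)))))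
      ... | no _ | yes b∈σ = ∈-++⁺ʳ (links (suc j)) (∈-++⁺ʳ (cones a) (subst (_∈ₗ cones b) (⁅x⁆∪[p-x]≡p b∈σ)
                            (∈-map⁺ (⁅ b ⁆ ∪_) (proj₂ (∈-faces (lk e K) j) (B.uncone bstσ b∈σ)))))
      ... | no a∉σ | no b∉σ = ∈-++⁺ˡ (proj₂ (∈-faces (lk e K) (suc j))
            (proj₂ (T-lk e K) (proj₁ (proj₁ (T-bst e K) (proj₁ bstσ)) , endpoints∉σ) , proj₂ bstσ))
        where
        endpoints∉σ : ∀ {z} → z ∈ e → z ∉ σ
        endpoints∉σ z∈e with ∈-pair⁻ z∈e
        ... | inj₁ refl = a∉σ
        ... | inj₂ refl = b∉σ

    nFaces-bst-pair : nFaces (bst e K) (suc j) ≡ nFaces (lk e K) (suc j) + (nFaces (lk e K) j + nFaces (lk e K) j)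
    nFaces-bst-pair = begin
      nFaces (bst e K) (suc j)
        ≡⟨ nFaces-enumerated (bst e K) (suc j) Unique-links++cones ∈-links++cones ⟩
      length (links (suc j) ++ (cones a ++ cones b))
        ≡⟨ length-++ (links (suc j)) ⟩
      nFaces (lk e K) (suc j) + length (cones a ++ cones b)
        ≡⟨ cong (nFaces (lk e K) (suc j) +_) (length-++ (cones a)) ⟩
      nFaces (lk e K) (suc j) + (length (cones a) + length (cones b))
        ≡⟨ cong (nFaces (lk e K) (suc j) +_) (cong₂ _+_ (length-map _ (links j)) (length-map _ (links j))) ⟩
      nFaces (lk e K) (suc j) + (nFaces (lk e K) j + nFaces (lk e K) j) ∎
      where open ≡-Reasoning

  nFaces-bst : ∀ (K : Cx n) e → ∣ e ∣ ≡ 2 → ∀ j →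
               nFaces (bst e K) (suc j) ≡ nFaces (lk e K) (suc j) + (nFaces (lk e K) j + nFaces (lk e K) j)
  nFaces-bst K e ∣e∣≡2 j = pair-elim _ (λ a≢b → EdgeStar.nFaces-bst-pair K a≢b j) {e} ∣e∣≡2

  nFaces-lk-∅ : ∀ (K : Cx n) e → T (K e) → nFaces (lk e K) 0 ≡ 1
  nFaces-lk-∅ {n} K e Ke = nFaces-enumerated (lk e K) 0 ([] ∷ [])
    ((λ { (here refl) → proj₂ (T-lk e K) (subst (T ∘ K) (sym (∪-identityʳ e)) Ke , λ _ → ∉⊥) , ∣⊥∣≡0 n }) ,
     (λ { (_ , ∣σ∣≡0) → here (∣p∣≡0⇒p≡∅ ∣σ∣≡0) }))

  -- The handshake lemma

  sigmaList : ∀ {A B : Set} → List A → (A → List B) → List (A × B)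
  sigmaList [] F = []
  sigmaList (x ∷ xs) F = map (x ,_) (F x) ++ sigmaList xs F

  module _ {A B : Set} where

    ∈-sigmaList : ∀ (xs : List A) (F : A → List B) {x y} → ((x , y) ∈ₗ sigmaList xs F) ⇔ (x ∈ₗ xs × y ∈ₗ F x)
    ∈-sigmaList xs F = to-Σ xs , from-Σ xs
      where
      to-Σ : ∀ xs {x y} → (x , y) ∈ₗ sigmaList xs F → x ∈ₗ xs × y ∈ₗ F x
      to-Σ (z ∷ xs) xy∈ with ∈-++⁻ (map (z ,_) (F z)) xy∈
      ... | inj₁ xy∈z with ∈-map⁻ (z ,_) xy∈z
      ...   | _ , y∈ , refl = here refl , y∈
      to-Σ (z ∷ xs) xy∈ | inj₂ xy∈xs = map₁ there (to-Σ xs xy∈xs)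
      from-Σ : ∀ xs {x y} → x ∈ₗ xs × y ∈ₗ F x → (x , y) ∈ₗ sigmaList xs F
      from-Σ (z ∷ xs) (here refl , y∈) = ∈-++⁺ˡ (∈-map⁺ (z ,_) y∈)
      from-Σ (z ∷ xs) (there x∈ , y∈) = ∈-++⁺ʳ (map (z ,_) (F z)) (from-Σ xs (x∈ , y∈))

    Unique-sigmaList : ∀ {xs : List A} (F : A → List B) → Unique xs → (∀ x → Unique (F x)) → Unique (sigmaList xs F)
    Unique-sigmaList F [] _ = []
    Unique-sigmaList {x ∷ xs} F (x∉xs ∷ u) uF =
      Unique.++⁺ (Unique.map⁺ ,-injectiveʳ (uF x)) (Unique-sigmaList F u uF)
        λ { (xy∈x , xy∈xs) → head-∉ (∈-map⁻ (x ,_) xy∈x) xy∈xs }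
      where
      head-∉ : ∀ {z} → (∃ λ y → y ∈ₗ F x × z ≡ (x , y)) → z ∈ₗ sigmaList xs F → ⊥
      head-∉ (_ , _ , refl) xy∈xs = All.lookup x∉xs (proj₁ (proj₁ (∈-sigmaList xs F) xy∈xs)) refl

    length-sigmaList : ∀ {xs : List A} (F : A → List B) c → (∀ {x} → x ∈ₗ xs → length (F x) ≡ c) →
                       length (sigmaList xs F) ≡ c * length xs
    length-sigmaList {[]} F c _ = sym (*-zeroʳ c)
    length-sigmaList {x ∷ xs} F c ∣F∣≡c = begin
      length (map (x ,_) (F x) ++ sigmaList xs F)        ≡⟨ length-++ (map (x ,_) (F x)) ⟩
      length (map (x ,_) (F x)) + length (sigmaList xs F) ≡⟨ cong₂ _+_ (trans (length-map _ (F x)) (∣F∣≡c (here refl)))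
                                                                       (length-sigmaList F c (∣F∣≡c ∘ there)) ⟩
      c + c * length xs                                  ≡⟨ *-suc c (length xs) ⟨
      c * suc (length xs)                                ∎
      where open ≡-Reasoning

  -- Double counting the pairs (edge, endpoint): through each vertex v (deg v = 2) and through each
  -- edge (2 endpoints).
  module Handshake {C : Cx n} (cx : IsComplex C) (2-regular : ∀ v → T (isVertex C v) → degree C v ≡ 2) where

    vertices : List (Fin n)
    vertices = filterᵇ (isVertex C) (allFin n)

    neighbours : Fin n → List (Fin n)
    neighbours v = filterᵇ (λ w → C (pair v w) ∧ not ⌊ v ≟ w ⌋) (allFin n)

    darts : List (Fin n × Fin n)
    darts = sigmaList vertices neighbours

    incidences : List (Subset n × Fin n)
    incidences = sigmaList (faces C 2) elements

    toIncidence : Fin n × Fin n → Subset n × Fin n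
    toIncidence (v , w) = pair v w , v

    vertex : ∀ {v} → v ∈ₗ vertices → T (isVertex C v)
    vertex = proj₂ ∘ ∈-filter⁻ (T? ∘ isVertex C) {xs = allFin n}

    f₀≡length-vertices : f C 0 ≡ length vertices
    f₀≡length-vertices = trans
      (nFaces-enumerated C 1 (Unique.map⁺ ⁅⁆-injective (Unique.filter⁺ (T? ∘ isVertex C) (Unique.allFin⁺ n)))
        ((λ σ∈ → let (v , v∈ , σ≡⁅v⁆) = ∈-map⁻ ⁅_⁆ σ∈ in subst (Face C 1) (sym σ≡⁅v⁆) (vertex v∈ , ∣⁅x⁆∣≡1 v)) ,
         (λ { (Cσ , ∣σ∣≡1) → let (v , σ≡⁅v⁆) = ∣p∣≡1⇒⁅x⁆ ∣σ∣≡1 in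
              subst (_∈ₗ map ⁅_⁆ vertices) (sym σ≡⁅v⁆)
                (∈-map⁺ ⁅_⁆ (∈-filter⁺ (T? ∘ isVertex C) (∈-allFin v) (subst (T ∘ C) σ≡⁅v⁆ Cσ))) })))
      (length-map ⁅_⁆ vertices)
      where
      ⁅⁆-injective : ∀ {x y : Fin n} → ⁅ x ⁆ ≡ ⁅ y ⁆ → x ≡ y
      ⁅⁆-injective {x} {y} eq = x∈⁅y⁆⇒x≡y y (subst (x ∈_) eq (x∈⁅x⁆ x))

    ∈-darts : ∀ {v w} → ((v , w) ∈ₗ darts) ⇔ (T (C (pair v w)) × v ≢ w)
    ∈-darts {v} {w} =
      (λ vw∈ → let w∈ = proj₂ (proj₁ (∈-sigmaList vertices neighbours) vw∈)
                   (Cvw , v≢w) = to T-∧ (proj₂ (∈-filter⁻ (T? ∘ _) {xs = allFin n} w∈))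
               in Cvw , proj₁ T-not v≢w ∘ fromWitness) ,
      (λ { (Cvw , v≢w) → proj₂ (∈-sigmaList vertices neighbours)
             ( ∈-filter⁺ (T? ∘ isVertex C) (∈-allFin v) (face-⊆ cx (p⊆p∪q ⁅ w ⁆) Cvw)
             , ∈-filter⁺ (T? ∘ _) (∈-allFin w) (from T-∧ (Cvw , proj₂ T-not (v≢w ∘ toWitness)))) })

    Unique-map-toIncidence : Unique (map toIncidence darts)
    Unique-map-toIncidence = Unique-map⁺-on toIncidence
      (Unique-sigmaList neighbours (Unique.filter⁺ (T? ∘ isVertex C) (Unique.allFin⁺ n))
                        (λ v → Unique.filter⁺ (T? ∘ _) (Unique.allFin⁺ n)))
      injective
      where
      injective : ∀ {d d′} → d ∈ₗ darts → d′ ∈ₗ darts → toIncidence d ≡ toIncidence d′ → d ≡ d′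
      injective {v , w} {v′ , w′} d∈ d′∈ eq with ,-injective eq
      ... | vw≡v′w′ , refl with ∈-pair⁻ (subst (w ∈_) vw≡v′w′ (y∈pair v w))
      ...   | inj₁ refl = ⊥-elim (proj₂ (proj₁ ∈-darts d∈) refl)
      ...   | inj₂ refl = refl

    incidences≈darts : ∀ {i} → (i ∈ₗ incidences) ⇔ (i ∈ₗ map toIncidence darts)
    incidences≈darts {ε , x} = to-darts , from-darts
      where
      dart : ∀ {c d} → c ≢ d → T (C (pair c d)) → x ∈ pair c d → (pair c d , x) ∈ₗ map toIncidence darts
      dart {c} c≢d Ccd x∈cd with ∈-pair⁻ x∈cd
      ... | inj₁ refl = ∈-map⁺ toIncidence (proj₂ ∈-darts (Ccd , c≢d))
      ... | inj₂ refl = subst (λ ε′ → (ε′ , x) ∈ₗ map toIncidence darts) (pair-comm x c)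
                          (∈-map⁺ toIncidence (proj₂ ∈-darts (subst (T ∘ C) (pair-comm c x) Ccd , c≢d ∘ sym)))
      to-darts : (ε , x) ∈ₗ incidences → (ε , x) ∈ₗ map toIncidence darts
      to-darts εx∈ =
        let (ε∈ , x∈ε) = proj₁ (∈-sigmaList (faces C 2) elements) εx∈
            (Cε , ∣ε∣≡2) = proj₁ (∈-faces C 2) ε∈
        in pair-elim (λ ε → T (C ε) → x ∈ ε → (ε , x) ∈ₗ map toIncidence darts) dart ∣ε∣≡2 Cε
                     (proj₁ (∈-elements ε) x∈ε)
      from-darts : (ε , x) ∈ₗ map toIncidence darts → (ε , x) ∈ₗ incidences
      from-darts εx∈ with ∈-map⁻ toIncidence εx∈
      ... | (v , w) , vw∈ , refl = let (Cvw , v≢w) = proj₁ ∈-darts vw∈ in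
        proj₂ (∈-sigmaList (faces C 2) elements)
          (proj₂ (∈-faces C 2) (Cvw , ∣pair∣≡2 v≢w) , proj₂ (∈-elements (pair v w)) (x∈pair v w))

    handshake : f C 1 ≡ f C 0
    handshake = *-cancelˡ-≡ (f C 1) (f C 0) 2 (begin
      2 * f C 1                       ≡⟨ length-sigmaList elements 2 length-edge ⟨
      length incidences               ≡⟨ unique∧set⇒length≡ Unique-incidences Unique-map-toIncidence incidences≈darts ⟩
      length (map toIncidence darts)  ≡⟨ length-map toIncidence darts ⟩
      length darts                    ≡⟨ length-sigmaList neighbours 2 (λ v∈ → 2-regular _ (vertex v∈)) ⟩
      2 * length vertices             ≡⟨ cong (2 *_) f₀≡length-vertices ⟨
      2 * f C 0                       ∎)
      where
      open ≡-Reasoning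
      Unique-incidences : Unique incidences
      Unique-incidences = Unique-sigmaList elements (Unique-faces C 2) Unique-elements
      length-edge : ∀ {ε} → ε ∈ₗ faces C 2 → length (elements ε) ≡ 2
      length-edge {ε} ε∈ = trans (sym (∣p∣≡length-elements ε)) (proj₂ (proj₁ (∈-faces C 2) ε∈))

  -- Edges of closed 3-manifolds

  lk-lk : ∀ (K : Cx n) {x y} → x ≢ y → ∀ {σ} → T (lk ⁅ y ⁆ (lk ⁅ x ⁆ K) σ) ⇔ T (lk (pair x y) K σ)
  lk-lk K {x} {y} x≢y {σ} =
    (λ h → let (lkx[y∪σ] , y∉σ) = proj₁ (T-lk ⁅ y ⁆ (lk ⁅ x ⁆ K)) h
               (K[x∪y∪σ] , x∉y∪σ) = proj₁ (T-lk ⁅ x ⁆ K) lkx[y∪σ]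
           in proj₂ (T-lk (pair x y) K) (subst (T ∘ K) (sym (∪-assoc ⁅ x ⁆ ⁅ y ⁆ σ)) K[x∪y∪σ] ,
                                         endpoints∉ (x∉y∪σ (x∈⁅x⁆ x) ∘ x∈p∪q⁺ ∘ inj₂) (y∉σ (x∈⁅x⁆ y)))) ,
    (λ h → let (K[xy∪σ] , xy∉σ) = proj₁ (T-lk (pair x y) K) h in
           proj₂ (T-lk ⁅ y ⁆ (lk ⁅ x ⁆ K))
             (proj₂ (T-lk ⁅ x ⁆ K) (subst (T ∘ K) (∪-assoc ⁅ x ⁆ ⁅ y ⁆ σ) K[xy∪σ] , x∉y∪σ xy∉σ) ,
              λ z∈⁅y⁆ → subst (_∉ σ) (sym (x∈⁅y⁆⇒x≡y y z∈⁅y⁆)) (xy∉σ (y∈pair x y))))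
    where
    endpoints∉ : x ∉ σ → y ∉ σ → ∀ {z} → z ∈ pair x y → z ∉ σ
    endpoints∉ x∉σ y∉σ z∈ with ∈-pair⁻ z∈
    ... | inj₁ refl = x∉σ
    ... | inj₂ refl = y∉σ
    x∉y∪σ : (∀ {z} → z ∈ pair x y → z ∉ σ) → ∀ {z} → z ∈ ⁅ x ⁆ → z ∉ ⁅ y ⁆ ∪ σ
    x∉y∪σ xy∉σ z∈⁅x⁆ z∈ with x∈⁅y⁆⇒x≡y x z∈⁅x⁆ | x∈p∪q⁻ ⁅ y ⁆ σ z∈
    ... | refl | inj₁ z∈⁅y⁆ = x≢y (x∈⁅y⁆⇒x≡y y z∈⁅y⁆)
    ... | refl | inj₂ z∈σ = xy∉σ (x∈pair x y) z∈σ

  -- lk(ab, K) = lk(b, lk(a, K)), which is a cycle because lk(a, K) is a 2-sphere.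
  lk-pair-f₁≡f₀ : ∀ {K : Cx n} {a b} → IsClosed3Manifold K → a ≢ b → T (K (pair a b)) →
                  f (lk (pair a b) K) 1 ≡ f (lk (pair a b) K) 0
  lk-pair-f₁≡f₀ {n} {K} {a} {b} (cx , vertex-links) a≢b Kab =
    trans (sym (same-faces 2))
          (trans (Handshake.handshake (proj₁ cycle) (proj₁ (proj₂ (proj₂ cycle)))) (same-faces 1))
    where
    a-vertex : T (isVertex K a)
    a-vertex = face-⊆ cx (p⊆p∪q ⁅ b ⁆) Kab
    b-vertex : T (isVertex (lk ⁅ a ⁆ K) b)
    b-vertex = proj₂ (T-lk ⁅ a ⁆ K) (Kab , λ z∈⁅a⁆ z∈⁅b⁆ → a≢b (trans (sym (x∈⁅y⁆⇒x≡y a z∈⁅a⁆)) (x∈⁅y⁆⇒x≡y b z∈⁅b⁆)))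
    cycle : IsCycle (lk ⁅ b ⁆ (lk ⁅ a ⁆ K))
    cycle = proj₁ (proj₂ (proj₂ (vertex-links a a-vertex))) b b-vertex
    same-faces : ∀ j → nFaces (lk ⁅ b ⁆ (lk ⁅ a ⁆ K)) j ≡ nFaces (lk (pair a b) K) j
    same-faces j = nFaces-cong (lk ⁅ b ⁆ (lk ⁅ a ⁆ K)) (lk (pair a b) K) j (λ _ → lk-lk K a≢b)

  edge-link-f₁≡f₀ : ∀ (K : Cx n) e → IsClosed3Manifold K → IsEdge K e → f (lk e K) 1 ≡ f (lk e K) 0
  edge-link-f₁≡f₀ K e M (Ke , ∣e∣≡2) =
    pair-elim (λ e → T (K e) → f (lk e K) 1 ≡ f (lk e K) 0) (lk-pair-f₁≡f₀ M) ∣e∣≡2 Ke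

  f-bst-vertices : ∀ (K : Cx n) e → IsEdge K e → f (bst e K) 0 ≡ f (lk e K) 0 + 2
  f-bst-vertices K e (Ke , ∣e∣≡2) =
    trans (nFaces-bst K e ∣e∣≡2 0) (cong (λ l → f (lk e K) 0 + (l + l)) (nFaces-lk-∅ K e Ke))

  f-bst-edges : ∀ (K : Cx n) e → IsClosed3Manifold K → IsEdge K e → f (bst e K) 1 ≡ 3 * f (lk e K) 0
  f-bst-edges {n} K e M (Ke , ∣e∣≡2) = begin
    f (bst e K) 1          ≡⟨ nFaces-bst K e ∣e∣≡2 1 ⟩
    f (lk e K) 1 + (ℓ + ℓ) ≡⟨ cong (_+ (ℓ + ℓ)) (edge-link-f₁≡f₀ K e M (Ke , ∣e∣≡2)) ⟩
    ℓ + (ℓ + ℓ)            ≡⟨ cong (λ x → ℓ + (ℓ + x)) (+-identityʳ ℓ) ⟨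
    3 * ℓ                  ∎
    where
    open ≡-Reasoning
    ℓ : ℕ
    ℓ = f (lk e K) 0

  T-∖del : ∀ (K : Cx n) e {σ} → T ((K ∖ del e K) σ) ⇔ (T (K σ) × e ⊆ σ)
  T-∖del K e {σ} with K σ | e ⊆ᵇ σ in e⊆ᵇσ
  ... | true | true = (λ _ → _ , proj₁ ⊆ᵇ⇔⊆ (from T-≡ e⊆ᵇσ)) , _
  ... | true | false = (λ ()) , λ { (_ , e⊆σ) → subst T e⊆ᵇσ (proj₂ ⊆ᵇ⇔⊆ e⊆σ) }
  ... | false | _ = (λ ()) , λ ()

  f-del-vertices : ∀ (K : Cx n) e → ∣ e ∣ ≡ 2 → f (del e K) 0 ≡ f K 0
  f-del-vertices K e ∣e∣≡2 = nFaces-cong (del e K) K 1 λ ∣σ∣≡1 →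
    (proj₁ ∘ proj₁ (T-del e K)) ,
    (λ Kσ → proj₂ (T-del e K) (Kσ , ∣∣<⇒⊈ (subst₂ _<_ (sym ∣σ∣≡1) (sym ∣e∣≡2) (s≤s (s≤s z≤n)))))

  f-del-edges : ∀ (K : Cx n) e → IsEdge K e → f K 1 ≡ f (del e K) 1 + 1
  f-del-edges K e (Ke , ∣e∣≡2) = trans (nFaces-∖ K (del e K) 2 (proj₁ ∘ proj₁ (T-del e K)))
    (cong (f (del e K) 1 +_) (nFaces-enumerated (K ∖ del e K) 2 ([] ∷ [])
      ((λ { (here refl) → proj₂ (T-∖del K e) (Ke , id) , ∣e∣≡2 }) ,
       (λ { (Kσ , ∣σ∣≡2) → here (sym (⊆∧∣∣≡⇒≡ (proj₂ (proj₁ (T-∖del K e) Kσ)) (trans ∣e∣≡2 (sym ∣σ∣≡2)))) }))))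

  -- Connected sums

  ∈-vertexSet : ∀ (K : Cx n) {v} → (v ∈ vertexSet K) ⇔ T (isVertex K v)
  ∈-vertexSet K {v} = (λ v∈ → subst T (lookup∘tabulate (isVertex K) v) (proj₁ (∈⇔T-lookup (vertexSet K)) v∈)) ,
                      (λ Kv → proj₂ (∈⇔T-lookup (vertexSet K)) (subst T (sym (lookup∘tabulate (isVertex K) v)) Kv))

  simpIso-face : ∀ (K : Cx n) (L : Cx m) {φ φ⁻} → IsSimpIso K L φ φ⁻ → ∀ {σ} →
                 (∀ {v} → v ∈ σ → T (isVertex K v)) → T (K σ) → T (L (image φ σ)) × ∣ image φ σ ∣ ≡ ∣ σ ∣
  simpIso-face K L {φ} {φ⁻} (inverse , _ , faces≡) {σ} σ⊆V Kσ =
    subst T (faces≡ σ (proj₂ ⊆ᵇ⇔⊆ (proj₂ (∈-vertexSet K) ∘ σ⊆V))) Kσ ,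
    ∣image∣ φ λ x∈ y∈ φx≡φy →
      trans (sym (proj₂ (inverse _ (σ⊆V x∈)))) (trans (cong φ⁻ φx≡φy) (proj₂ (inverse _ (σ⊆V y∈))))

  star-vertex : ∀ {K : Cx n} → IsComplex K → ∀ {e σ v} → T (K (e ∪ σ)) → v ∈ σ → T (K (e ∪ ⁅ v ⁆))
  star-vertex cx {e} {σ} {v} K[e∪σ] v∈σ = face-⊆ cx e∪v⊆e∪σ K[e∪σ]
    where
    e∪v⊆e∪σ : e ∪ ⁅ v ⁆ ⊆ e ∪ σ
    e∪v⊆e∪σ z∈ = x∈p∪q⁺ (Sum.map₂ (λ z∈⁅v⁆ → subst (_∈ σ) (sym (x∈⁅y⁆⇒x≡y v z∈⁅v⁆)) v∈σ) (x∈p∪q⁻ e ⁅ v ⁆ z∈))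

  bst-vertex : ∀ {K : Cx n} {e v} → ∣ e ∣ ≡ 2 → T (K (e ∪ ⁅ v ⁆)) → T (isVertex (bst e K) v)
  bst-vertex {K = K} {e} {v} ∣e∣≡2 K[e∪v] =
    proj₂ (T-bst e K) (K[e∪v] , ∣∣<⇒⊈ (subst₂ _<_ (sym (∣⁅x⁆∣≡1 v)) (sym ∣e∣≡2) (s≤s (s≤s z≤n))))

  module ConnectedSum {n₁ n₂ m} {Δ₁ : Cx n₁} {Δ₂ : Cx n₂} {e₁ e₂ φ φ⁻} {Γ : Cx m} {π₁ π₂}
                      (M₁ : IsFlag3Manifold Δ₁) (M₂ : IsFlag3Manifold Δ₂) (E₁ : IsEdge Δ₁ e₁) (E₂ : IsEdge Δ₂ e₂)
                      (iso : IsSimpIso (bst e₁ Δ₁) (bst e₂ Δ₂) φ φ⁻)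
                      (Γ-sum : IsConnSum Δ₁ Δ₂ e₁ e₂ φ Γ π₁ π₂) where

    private
      cx₁ : IsComplex Δ₁
      cx₁ = proj₁ (proj₂ M₁)
      cx₂ : IsComplex Δ₂
      cx₂ = proj₁ (proj₂ M₂)
      π₁-injective : ∀ v v′ → π₁ v ≡ π₁ v′ → v ≡ v′
      π₁-injective = proj₁ Γ-sum
      π₂-injective : ∀ w w′ → π₂ w ≡ π₂ w′ → w ≡ w′
      π₂-injective = proj₁ (proj₂ Γ-sum)
      glued : ∀ v w → (π₁ v ≡ π₂ w) ⇔ (T (isVertex (bst e₁ Δ₁) v) × w ≡ φ v)
      glued = proj₁ (proj₂ (proj₂ Γ-sum))
      Γ-faces : ∀ ρ → T (Γ ρ) ⇔ ((∃ λ σ → T (Δ₁ σ) × T (not (e₁ ⊆ᵇ σ)) × ρ ≡ image π₁ σ) ⊎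
                                  (∃ λ τ → T (Δ₂ τ) × T (not (e₂ ⊆ᵇ τ)) × ρ ≡ image π₂ τ))
      Γ-faces = proj₂ (proj₂ (proj₂ (proj₂ Γ-sum)))
      ∣π₁∣ : ∀ σ → ∣ image π₁ σ ∣ ≡ ∣ σ ∣
      ∣π₁∣ σ = ∣image∣ π₁ {σ} (λ _ _ → π₁-injective _ _)
      ∣π₂∣ : ∀ τ → ∣ image π₂ τ ∣ ≡ ∣ τ ∣
      ∣π₂∣ τ = ∣image∣ π₂ {τ} (λ _ _ → π₂-injective _ _)

    glued-face : ∀ {σ τ} → T (del e₁ Δ₁ σ) → image π₁ σ ≡ image π₂ τ → T (bst e₁ Δ₁ σ)
    glued-face {σ} {τ} delσ eq =
      let (Δ₁σ , e₁⊈σ) = proj₁ (T-del e₁ Δ₁) delσ in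
      proj₂ (T-bst e₁ Δ₁) (flag-star-closed cx₁ (proj₁ M₁) (proj₁ E₁) Δ₁σ vertex-in-star , e₁⊈σ)
      where
      vertex-in-star : ∀ {v} → v ∈ σ → T (Δ₁ (e₁ ∪ ⁅ v ⁆))
      vertex-in-star v∈σ with ∈-image⁻ π₂ τ (subst (_ ∈_) eq (∈-image⁺ π₁ v∈σ))
      ... | w , _ , π₂w≡π₁v = proj₁ (proj₁ (T-bst e₁ Δ₁) (proj₁ (proj₁ (glued _ w) (sym π₂w≡π₁v))))

    φ-transport : ∀ {j σ} → Face (bst e₁ Δ₁) j σ →
                  Face (del e₂ Δ₂) j (image φ σ) × image π₂ (image φ σ) ≡ image π₁ σ
    φ-transport {σ = σ} (bstσ , ∣σ∣≡j) =
      (bst⊆del {e = e₂} {Δ₂} cx₂ (proj₁ transported) , trans (proj₂ transported) ∣σ∣≡j) ,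
      trans (image-∘ π₂ φ σ) (image-cong (λ v∈σ → sym (proj₂ (glued _ _) (σ⊆V v∈σ , refl))))
      where
      σ⊆V : ∀ {v} → v ∈ σ → T (isVertex (bst e₁ Δ₁) v)
      σ⊆V v∈σ = bst-vertex {K = Δ₁} (proj₂ E₁) (star-vertex cx₁ (proj₁ (proj₁ (T-bst e₁ Δ₁) bstσ)) v∈σ)
      transported : T (bst e₂ Δ₂ (image φ σ)) × ∣ image φ σ ∣ ≡ ∣ σ ∣
      transported = simpIso-face (bst e₁ Δ₁) (bst e₂ Δ₂) iso σ⊆V bstσ

    Image₁ Image₂ : ℕ → Subset m → Set
    Image₁ j ρ = ∃ λ σ → Face (del e₁ Δ₁ ∖ bst e₁ Δ₁) j σ × image π₁ σ ≡ ρ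
    Image₂ j ρ = ∃ λ τ → Face (del e₂ Δ₂) j τ × image π₂ τ ≡ ρ

    Γ-faces≈ : ∀ j {ρ} → Face Γ j ρ ⇔ (Image₁ j ρ ⊎ Image₂ j ρ)
    Γ-faces≈ j {ρ} = to-images , from-images
      where
      to-images : Face Γ j ρ → Image₁ j ρ ⊎ Image₂ j ρ
      to-images (Γρ , ∣ρ∣≡j) with proj₁ (Γ-faces ρ) Γρ
      ... | inj₂ (τ , Δ₂τ , e₂⊈τ , refl) = inj₂ (τ , (from T-∧ (Δ₂τ , e₂⊈τ) , trans (sym (∣π₂∣ τ)) ∣ρ∣≡j) , refl)
      ... | inj₁ (σ , Δ₁σ , e₁⊈σ , refl) with bst e₁ Δ₁ σ in bstσ≡
      ...   | false = inj₁ (σ , (from T-∧ (from T-∧ (Δ₁σ , e₁⊈σ) , from T-not-≡ bstσ≡) ,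
                                 trans (sym (∣π₁∣ σ)) ∣ρ∣≡j) , refl)
      ...   | true = let (delφσ , π₂φσ≡π₁σ) = φ-transport (from T-≡ bstσ≡ , trans (sym (∣π₁∣ σ)) ∣ρ∣≡j) in
                     inj₂ (image φ σ , delφσ , π₂φσ≡π₁σ)
      from-images : Image₁ j ρ ⊎ Image₂ j ρ → Face Γ j ρ
      from-images (inj₁ (σ , (kept₁σ , ∣σ∣≡j) , refl)) =
        let (Δ₁σ , e₁⊈σ) = to T-∧ (proj₁ (to T-∧ kept₁σ)) in
        proj₂ (Γ-faces _) (inj₁ (σ , Δ₁σ , e₁⊈σ , refl)) , trans (∣π₁∣ σ) ∣σ∣≡j
      from-images (inj₂ (τ , (delτ , ∣τ∣≡j) , refl)) =
        let (Δ₂τ , e₂⊈τ) = to T-∧ delτ in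
        proj₂ (Γ-faces _) (inj₂ (τ , Δ₂τ , e₂⊈τ , refl)) , trans (∣π₂∣ τ) ∣τ∣≡j

    nFaces-Γ : ∀ j → nFaces Γ j + nFaces (bst e₁ Δ₁) j ≡ nFaces (del e₁ Δ₁) j + nFaces (del e₂ Δ₂) j
    nFaces-Γ j = begin
      nFaces Γ j + B   ≡⟨ cong (_+ B) (nFaces-image₂ _ _ Γ j (image π₁) (image π₂)
                               (λ _ _ → image-injective π₁ (π₁-injective _ _))
                               (λ _ _ → image-injective π₂ (π₂-injective _ _))
                               (λ {_} {τ} (kept₁σ , _) _ eq → let (delσ , σ∉bst) = to T-∧ kept₁σ in
                                                              proj₁ T-not σ∉bst (glued-face {τ = τ} delσ eq))
                               (Γ-faces≈ j)) ⟩
      (A + D₂) + B     ≡⟨ rearrange A D₂ B ⟩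
      (B + A) + D₂     ≡⟨ cong (_+ D₂) (nFaces-∖ (del e₁ Δ₁) (bst e₁ Δ₁) j (bst⊆del cx₁)) ⟨
      nFaces (del e₁ Δ₁) j + D₂ ∎
      where
      open ≡-Reasoning
      A B D₂ : ℕ
      A = nFaces (del e₁ Δ₁ ∖ bst e₁ Δ₁) j
      B = nFaces (bst e₁ Δ₁) j
      D₂ = nFaces (del e₂ Δ₂) j
      rearrange : ∀ a d b → (a + d) + b ≡ (b + a) + d
      rearrange = solve-∀

    f₀-Γ : f Γ 0 + (f (lk e₁ Δ₁) 0 + 2) ≡ f Δ₁ 0 + f Δ₂ 0
    f₀-Γ = begin
      f Γ 0 + (f (lk e₁ Δ₁) 0 + 2)        ≡⟨ cong (f Γ 0 +_) (f-bst-vertices Δ₁ e₁ E₁) ⟨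
      f Γ 0 + f (bst e₁ Δ₁) 0             ≡⟨ nFaces-Γ 1 ⟩
      f (del e₁ Δ₁) 0 + f (del e₂ Δ₂) 0
        ≡⟨ cong₂ _+_ (f-del-vertices Δ₁ e₁ (proj₂ E₁)) (f-del-vertices Δ₂ e₂ (proj₂ E₂)) ⟩
      f Δ₁ 0 + f Δ₂ 0                     ∎
      where open ≡-Reasoning

    f₁-Γ : f Γ 1 + (3 * f (lk e₁ Δ₁) 0 + 2) ≡ f Δ₁ 1 + f Δ₂ 1
    f₁-Γ = begin
      f Γ 1 + (3 * f (lk e₁ Δ₁) 0 + 2)              ≡⟨ cong (λ x → f Γ 1 + (x + 2)) (f-bst-edges Δ₁ e₁ (proj₂ M₁) E₁) ⟨
      f Γ 1 + (f (bst e₁ Δ₁) 1 + 2)                 ≡⟨ +-assoc (f Γ 1) _ 2 ⟨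
      f Γ 1 + f (bst e₁ Δ₁) 1 + 2                   ≡⟨ cong (_+ 2) (nFaces-Γ 2) ⟩
      f (del e₁ Δ₁) 1 + f (del e₂ Δ₂) 1 + 2         ≡⟨ split-2 (f (del e₁ Δ₁) 1) (f (del e₂ Δ₂) 1) ⟩
      (f (del e₁ Δ₁) 1 + 1) + (f (del e₂ Δ₂) 1 + 1) ≡⟨ cong₂ _+_ (f-del-edges Δ₁ e₁ E₁) (f-del-edges Δ₂ e₂ E₂) ⟨
      f Δ₁ 1 + f Δ₂ 1                               ∎
      where
      open ≡-Reasoning
      split-2 : ∀ x y → x + y + 2 ≡ (x + 1) + (y + 1)
      split-2 = solve-∀

  -- Handle additions

  module HandleAddition {n m} {Δ : Cx n} {σ₁ σ₂ ψ ψ⁻} {Γ : Cx m} {π}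
                        (M : IsFlag3Manifold Δ) (E₁ : IsEdge Δ σ₁) (E₂ : IsEdge Δ σ₂)
                        (iso : IsSimpIso (bst σ₁ Δ) (bst σ₂ Δ) ψ ψ⁻)
                        (far : DistGe4 Δ (vertexSet (st σ₁ Δ)) (vertexSet (st σ₂ Δ)))
                        (Γ-handle : IsHandleAdd Δ σ₁ σ₂ ψ Γ π) where

    W₁ W₂ : Fin n → Set
    W₁ v = T (isVertex (st σ₁ Δ) v)
    W₂ v = T (isVertex (st σ₂ Δ) v)

    private
      cx : IsComplex Δ
      cx = proj₁ (proj₂ M)
      identified : ∀ u v → (π u ≡ π v) ⇔ (u ≡ v ⊎ (W₁ u × v ≡ ψ u) ⊎ (W₁ v × u ≡ ψ v))
      identified = proj₁ Γ-handle
      Γ-faces : ∀ ρ → T (Γ ρ) ⇔ (∃ λ τ → T (Δ τ) × T (not (σ₁ ⊆ᵇ τ)) × T (not (σ₂ ⊆ᵇ τ)) × ρ ≡ image π τ)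
      Γ-faces = proj₂ (proj₂ Γ-handle)
      far-apart : ∀ {u v k} → W₁ u → W₂ v → Walk Δ u v k → 4 ≤ k
      far-apart {u} {v} u∈W₁ v∈W₂ =
        far u v _ (subst T (sym (lookup∘tabulate _ u)) u∈W₁) (subst T (sym (lookup∘tabulate _ v)) v∈W₂)

    W-disjoint : ∀ {u} → W₁ u → W₂ u → ⊥
    W-disjoint u∈W₁ u∈W₂ with () ← far-apart u∈W₁ u∈W₂ here

    W-nonadjacent : ∀ {u v} → W₁ u → W₂ v → T (Δ (pair u v)) → ⊥
    W-nonadjacent u∈W₁ v∈W₂ uv with s≤s () ← far-apart u∈W₁ v∈W₂ (step uv here)

    W-no-common-neighbour : ∀ {u x v} → W₁ u → W₂ v → T (Δ (pair u x)) → T (Δ (pair x v)) → ⊥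
    W-no-common-neighbour u∈W₁ v∈W₂ ux xv with s≤s (s≤s ()) ← far-apart u∈W₁ v∈W₂ (step ux (step xv here))

    edge-of : ∀ {τ x y} → T (Δ τ) → x ∈ τ → y ∈ τ → T (Δ (pair x y))
    edge-of Δτ x∈τ y∈τ = face-⊆ cx (pair⊆ x∈τ y∈τ) Δτ

    ψ-W : ∀ {u} → W₁ u → W₂ (ψ u)
    ψ-W u∈W₁ = proj₁ (proj₁ (T-bst σ₂ Δ) (proj₁ (proj₁ iso _ (bst-vertex {K = Δ} (proj₂ E₁) u∈W₁))))

    shared-vertex : ∀ {σ σ′ τ} → IsEdge Δ σ → T (Δ (σ′ ∪ τ)) → σ ⊆ τ →
                    ∃ λ c → T (Δ (σ ∪ ⁅ c ⁆)) × T (Δ (σ′ ∪ ⁅ c ⁆))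
    shared-vertex (Δσ , ∣σ∣≡2) Δ[σ′∪τ] σ⊆τ with ∣p∣≡suc⇒Nonempty ∣σ∣≡2
    ... | c , c∈σ = c , star-vertex cx (subst (T ∘ Δ) (sym (∪-idem _)) Δσ) c∈σ , star-vertex cx Δ[σ′∪τ] (σ⊆τ c∈σ)

    σ₁⊈star₂ : ∀ {τ} → T (Δ (σ₂ ∪ τ)) → ¬ σ₁ ⊆ τ
    σ₁⊈star₂ Δ[σ₂∪τ] σ₁⊆τ = let (c , c∈W₁ , c∈W₂) = shared-vertex E₁ Δ[σ₂∪τ] σ₁⊆τ in W-disjoint c∈W₁ c∈W₂

    σ₂⊈star₁ : ∀ {τ} → T (Δ (σ₁ ∪ τ)) → ¬ σ₂ ⊆ τ
    σ₂⊈star₁ Δ[σ₁∪τ] σ₂⊆τ = let (c , c∈W₂ , c∈W₁) = shared-vertex E₂ Δ[σ₁∪τ] σ₂⊆τ in W-disjoint c∈W₁ c∈W₂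

    π-injective-on-faces : ∀ {τ} → T (Δ τ) → ∀ {x y} → x ∈ τ → y ∈ τ → π x ≡ π y → x ≡ y
    π-injective-on-faces Δτ x∈τ y∈τ πx≡πy with proj₁ (identified _ _) πx≡πy
    ... | inj₁ x≡y = x≡y
    ... | inj₂ (inj₁ (x∈W₁ , refl)) = ⊥-elim (W-nonadjacent x∈W₁ (ψ-W x∈W₁) (edge-of Δτ x∈τ y∈τ))
    ... | inj₂ (inj₂ (y∈W₁ , refl)) = ⊥-elim (W-nonadjacent y∈W₁ (ψ-W y∈W₁) (edge-of Δτ y∈τ x∈τ))

    ∣πτ∣ : ∀ {τ} → T (Δ τ) → ∣ image π τ ∣ ≡ ∣ τ ∣
    ∣πτ∣ Δτ = ∣image∣ π (π-injective-on-faces Δτ)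

    -- The faces of Δ that survive in Γ, with the copy of ∂st(σ₁) left out (it is identified with ∂st(σ₂)).
    kept : Cx n
    kept = del σ₂ (del σ₁ Δ) ∖ bst σ₁ Δ

    T-kept : ∀ {τ} → T (kept τ) ⇔ (T (Δ τ) × ¬ σ₁ ⊆ τ × ¬ σ₂ ⊆ τ × ¬ T (bst σ₁ Δ τ))
    T-kept =
      (λ keptτ → let (del₂₁τ , τ∉bst) = to T-∧ keptτ
                     (del₁τ , σ₂⊈τ) = proj₁ (T-del σ₂ (del σ₁ Δ)) del₂₁τ
                     (Δτ , σ₁⊈τ) = proj₁ (T-del σ₁ Δ) del₁τ
                 in Δτ , σ₁⊈τ , σ₂⊈τ , proj₁ T-not τ∉bst) ,
      (λ { (Δτ , σ₁⊈τ , σ₂⊈τ , τ∉bst) →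
           from T-∧ (proj₂ (T-del σ₂ (del σ₁ Δ)) (proj₂ (T-del σ₁ Δ) (Δτ , σ₁⊈τ) , σ₂⊈τ) , proj₂ T-not τ∉bst) })

    -- Two kept faces with the same image cannot meet W₁ and W₂ respectively: by distance ≥ 3, every
    -- vertex of the first would lie in W₁, which puts the first face in ∂st(σ₁) by flagness.
    no-crossing : ∀ {τ₁ τ₂} → T (kept τ₁) → T (Δ τ₂) → image π τ₁ ≡ image π τ₂ →
                  ∀ {p q} → p ∈ τ₁ → W₁ p → q ∈ τ₂ → W₂ q → ⊥
    no-crossing {τ₁} {τ₂} keptτ₁ Δτ₂ eq {p} {q} p∈τ₁ p∈W₁ q∈τ₂ q∈W₂ =
      let (Δτ₁ , σ₁⊈τ₁ , _ , τ₁∉bst) = proj₁ T-kept keptτ₁ in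
      τ₁∉bst (proj₂ (T-bst σ₁ Δ) (flag-star-closed cx (proj₁ M) (proj₁ E₁) Δτ₁ (all-in-W₁ Δτ₁) , σ₁⊈τ₁))
      where
      all-in-W₁ : T (Δ τ₁) → ∀ {x} → x ∈ τ₁ → W₁ x
      all-in-W₁ Δτ₁ {x} x∈τ₁ with T? (Δ (σ₁ ∪ ⁅ x ⁆))
      ... | yes x∈W₁ = x∈W₁
      ... | no x∉W₁ with ∈-image⁻ π τ₂ (subst (π x ∈_) eq (∈-image⁺ π x∈τ₁))
      ...   | y , y∈τ₂ , πy≡πx with proj₁ (identified y x) πy≡πx
      ...     | inj₁ refl =
        ⊥-elim (W-no-common-neighbour p∈W₁ q∈W₂ (edge-of Δτ₁ p∈τ₁ x∈τ₁) (edge-of Δτ₂ y∈τ₂ q∈τ₂))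
      ...     | inj₂ (inj₁ (y∈W₁ , _)) = ⊥-elim (W-nonadjacent y∈W₁ q∈W₂ (edge-of Δτ₂ y∈τ₂ q∈τ₂))
      ...     | inj₂ (inj₂ (x∈W₁ , _)) = ⊥-elim (x∉W₁ x∈W₁)

    kept-injective : ∀ {τ τ′} → T (kept τ) → T (kept τ′) → image π τ ≡ image π τ′ → τ ≡ τ′
    kept-injective keptτ keptτ′ eq = ⊆-antisym (⊆-by-image keptτ keptτ′ eq) (⊆-by-image keptτ′ keptτ (sym eq))
      where
      ⊆-by-image : ∀ {τ τ′} → T (kept τ) → T (kept τ′) → image π τ ≡ image π τ′ → τ ⊆ τ′
      ⊆-by-image {τ} {τ′} keptτ keptτ′ eq {v} v∈τ with ∈-image⁻ π τ′ (subst (π v ∈_) eq (∈-image⁺ π v∈τ))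
      ... | v′ , v′∈τ′ , πv′≡πv with proj₁ (identified v′ v) πv′≡πv
      ...   | inj₁ refl = v′∈τ′
      ...   | inj₂ (inj₁ (v′∈W₁ , refl)) =
        ⊥-elim (no-crossing keptτ′ (proj₁ (proj₁ T-kept keptτ)) (sym eq) v′∈τ′ v′∈W₁ v∈τ (ψ-W v′∈W₁))
      ...   | inj₂ (inj₂ (v∈W₁ , refl)) =
        ⊥-elim (no-crossing keptτ (proj₁ (proj₁ T-kept keptτ′)) eq v∈τ v∈W₁ v′∈τ′ (ψ-W v∈W₁))

    ψ-transport : ∀ {j τ} → Face (bst σ₁ Δ) (suc j) τ →
                  Face kept (suc j) (image ψ τ) × image π (image ψ τ) ≡ image π τ
    ψ-transport {j} {τ} (bstτ , ∣τ∣≡1+j) =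
      (proj₂ T-kept (Δψτ , σ₁⊈star₂ Δ[σ₂∪ψτ] , σ₂⊈ψτ , ψτ∉bst₁) , ∣ψτ∣≡1+j) ,
      trans (image-∘ π ψ τ) (image-cong λ v∈τ → sym (proj₂ (identified _ _) (inj₂ (inj₁ (W₁-vertex v∈τ , refl)))))
      where
      W₁-vertex : ∀ {v} → v ∈ τ → W₁ v
      W₁-vertex = star-vertex cx (proj₁ (proj₁ (T-bst σ₁ Δ) bstτ))
      transported : T (bst σ₂ Δ (image ψ τ)) × ∣ image ψ τ ∣ ≡ ∣ τ ∣
      transported = simpIso-face (bst σ₁ Δ) (bst σ₂ Δ) iso (bst-vertex {K = Δ} (proj₂ E₁) ∘ W₁-vertex) bstτ
      ∣ψτ∣≡1+j : ∣ image ψ τ ∣ ≡ suc j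
      ∣ψτ∣≡1+j = trans (proj₂ transported) ∣τ∣≡1+j
      Δ[σ₂∪ψτ] : T (Δ (σ₂ ∪ image ψ τ))
      Δ[σ₂∪ψτ] = proj₁ (proj₁ (T-bst σ₂ Δ) (proj₁ transported))
      σ₂⊈ψτ : ¬ σ₂ ⊆ image ψ τ
      σ₂⊈ψτ = proj₂ (proj₁ (T-bst σ₂ Δ) (proj₁ transported))
      Δψτ : T (Δ (image ψ τ))
      Δψτ = face-⊆ cx (q⊆p∪q _ _) Δ[σ₂∪ψτ]
      ψτ∉bst₁ : ¬ T (bst σ₁ Δ (image ψ τ))
      ψτ∉bst₁ bst₁ψτ = let (c , c∈ψτ) = ∣p∣≡suc⇒Nonempty ∣ψτ∣≡1+j in
        W-disjoint (star-vertex cx (proj₁ (proj₁ (T-bst σ₁ Δ) bst₁ψτ)) c∈ψτ) (star-vertex cx Δ[σ₂∪ψτ] c∈ψτ)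

    Γ-faces≈ : ∀ k {ρ} → Face Γ (suc k) ρ ⇔ (∃ λ τ → Face kept (suc k) τ × image π τ ≡ ρ)
    Γ-faces≈ k {ρ} = to-kept , from-kept
      where
      to-kept : Face Γ (suc k) ρ → ∃ λ τ → Face kept (suc k) τ × image π τ ≡ ρ
      to-kept (Γρ , ∣ρ∣≡1+k) with proj₁ (Γ-faces ρ) Γρ
      ... | τ , Δτ , σ₁⊈τ , σ₂⊈τ , refl with bst σ₁ Δ τ in bstτ≡
      ...   | false = τ , (proj₂ T-kept (Δτ , proj₁ T-not-⊆ᵇ σ₁⊈τ , proj₁ T-not-⊆ᵇ σ₂⊈τ , subst T bstτ≡) ,
                           trans (sym (∣πτ∣ Δτ)) ∣ρ∣≡1+k) , refl
      ...   | true = let (keptψτ , πψτ≡πτ) = ψ-transport (from T-≡ bstτ≡ , trans (sym (∣πτ∣ Δτ)) ∣ρ∣≡1+k) in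
                     image ψ τ , keptψτ , πψτ≡πτ
      from-kept : (∃ λ τ → Face kept (suc k) τ × image π τ ≡ ρ) → Face Γ (suc k) ρ
      from-kept (τ , (keptτ , ∣τ∣≡1+k) , refl) =
        let (Δτ , σ₁⊈τ , σ₂⊈τ , _) = proj₁ T-kept keptτ in
        proj₂ (Γ-faces _) (τ , Δτ , proj₂ T-not-⊆ᵇ σ₁⊈τ , proj₂ T-not-⊆ᵇ σ₂⊈τ , refl) , trans (∣πτ∣ Δτ) ∣τ∣≡1+k

    nFaces-Γ : ∀ k → nFaces Γ (suc k) + nFaces (bst σ₁ Δ) (suc k) ≡ nFaces (del σ₂ (del σ₁ Δ)) (suc k)
    nFaces-Γ k = begin
      nFaces Γ (suc k) + B                   ≡⟨ cong (_+ B) (nFaces-image kept Γ (suc k) (image π)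
                                                   (λ (keptτ , _) (keptτ′ , _) → kept-injective keptτ keptτ′)
                                                   (Γ-faces≈ k)) ⟩
      nFaces kept (suc k) + B                ≡⟨ +-comm (nFaces kept (suc k)) B ⟩
      B + nFaces kept (suc k)                ≡⟨ nFaces-∖ (del σ₂ (del σ₁ Δ)) (bst σ₁ Δ) (suc k) bst⊆del₂₁ ⟨
      nFaces (del σ₂ (del σ₁ Δ)) (suc k)     ∎
      where
      open ≡-Reasoning
      B : ℕ
      B = nFaces (bst σ₁ Δ) (suc k)
      bst⊆del₂₁ : ∀ {τ} → T (bst σ₁ Δ τ) → T (del σ₂ (del σ₁ Δ) τ)
      bst⊆del₂₁ bstτ = proj₂ (T-del σ₂ (del σ₁ Δ))
        (bst⊆del {e = σ₁} {Δ} cx bstτ , σ₂⊈star₁ (proj₁ (proj₁ (T-bst σ₁ Δ) bstτ)))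

    σ₂-edge-of-del : IsEdge (del σ₁ Δ) σ₂
    σ₂-edge-of-del = proj₂ (T-del σ₁ Δ) (proj₁ E₂ , σ₁⊈star₂ (subst (T ∘ Δ) (sym (∪-idem σ₂)) (proj₁ E₂))) , proj₂ E₂

    f₀-Γ : f Γ 0 + (f (lk σ₁ Δ) 0 + 2) ≡ f Δ 0
    f₀-Γ = begin
      f Γ 0 + (f (lk σ₁ Δ) 0 + 2)     ≡⟨ cong (f Γ 0 +_) (f-bst-vertices Δ σ₁ E₁) ⟨
      f Γ 0 + f (bst σ₁ Δ) 0          ≡⟨ nFaces-Γ 0 ⟩
      f (del σ₂ (del σ₁ Δ)) 0         ≡⟨ f-del-vertices (del σ₁ Δ) σ₂ (proj₂ E₂) ⟩
      f (del σ₁ Δ) 0                  ≡⟨ f-del-vertices Δ σ₁ (proj₂ E₁) ⟩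
      f Δ 0                           ∎
      where open ≡-Reasoning

    f₁-Γ : f Γ 1 + (3 * f (lk σ₁ Δ) 0 + 2) ≡ f Δ 1
    f₁-Γ = begin
      f Γ 1 + (3 * f (lk σ₁ Δ) 0 + 2)  ≡⟨ cong (λ x → f Γ 1 + (x + 2)) (f-bst-edges Δ σ₁ (proj₂ M) E₁) ⟨
      f Γ 1 + (f (bst σ₁ Δ) 1 + 2)     ≡⟨ +-assoc (f Γ 1) (f (bst σ₁ Δ) 1) 2 ⟨
      f Γ 1 + f (bst σ₁ Δ) 1 + 2       ≡⟨ cong (_+ 2) (nFaces-Γ 1) ⟩
      f (del σ₂ (del σ₁ Δ)) 1 + 2      ≡⟨ +-assoc (f (del σ₂ (del σ₁ Δ)) 1) 1 1 ⟨
      f (del σ₂ (del σ₁ Δ)) 1 + 1 + 1  ≡⟨ cong (_+ 1) (f-del-edges (del σ₁ Δ) σ₂ σ₂-edge-of-del) ⟨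
      f (del σ₁ Δ) 1 + 1               ≡⟨ f-del-edges Δ σ₁ E₁ ⟨
      f Δ 1                            ∎
      where open ≡-Reasoning

-- The γ-vector

open import Data.Integer using (ℤ; +_; _+_; _-_; _*_)
open import Data.Integer.Properties using (pos-+; pos-*)
open import Data.Integer.Tactic.RingSolver using (solve-∀)

γ₂′ : ℕ → ℕ → ℤ
γ₂′ f₀ f₁ = (+ f₁ - + (5 ℕ.* f₀)) + + 16

γ₂′≡ : ∀ f₀ f₁ → γ₂′ f₀ f₁ ≡ (+ f₁ - + 5 * + f₀) + + 16
γ₂′≡ f₀ f₁ = cong (λ x → (+ f₁ - x) + + 16) (pos-* 5 f₀)

γ₂-glue : ∀ (Γ : Cx m) ℓ {a₀ a₁} → f Γ 0 ℕ.+ (ℓ ℕ.+ 2) ≡ a₀ → f Γ 1 ℕ.+ (3 ℕ.* ℓ ℕ.+ 2) ≡ a₁ →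
          γ₂ Γ ≡ (γ₂′ a₀ a₁ + + 2 * (+ ℓ - + 4)) + + 16
γ₂-glue Γ ℓ refl refl = begin
  γ₂ Γ                                       ≡⟨ γ₂′≡ g₀ g₁ ⟩
  (+ g₁ - + 5 * + g₀) + + 16                 ≡⟨ identity (+ g₀) (+ g₁) (+ ℓ) ⟩
  ((((+ g₁ + (+ 3 * + ℓ + + 2)) - + 5 * (+ g₀ + (+ ℓ + + 2))) + + 16) + + 2 * (+ ℓ - + 4)) + + 16
    ≡⟨ cong (λ x → (x + + 2 * (+ ℓ - + 4)) + + 16)
            (sym (trans (γ₂′≡ (g₀ ℕ.+ (ℓ ℕ.+ 2)) (g₁ ℕ.+ (3 ℕ.* ℓ ℕ.+ 2)))
                        (cong₂ (λ x₁ x₀ → (x₁ - + 5 * x₀) + + 16) cast₁ cast₀))) ⟩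
  (γ₂′ (g₀ ℕ.+ (ℓ ℕ.+ 2)) (g₁ ℕ.+ (3 ℕ.* ℓ ℕ.+ 2)) + + 2 * (+ ℓ - + 4)) + + 16 ∎
  where
  open ≡-Reasoning
  g₀ g₁ : ℕ
  g₀ = f Γ 0
  g₁ = f Γ 1
  identity : ∀ g₀ g₁ ℓ → (g₁ - + 5 * g₀) + + 16 ≡
             ((((g₁ + (+ 3 * ℓ + + 2)) - + 5 * (g₀ + (ℓ + + 2))) + + 16) + + 2 * (ℓ - + 4)) + + 16
  identity = solve-∀
  cast₀ : + (g₀ ℕ.+ (ℓ ℕ.+ 2)) ≡ + g₀ + (+ ℓ + + 2)
  cast₀ = trans (pos-+ g₀ _) (cong (λ x → + g₀ + x) (pos-+ ℓ 2))
  cast₁ : + (g₁ ℕ.+ (3 ℕ.* ℓ ℕ.+ 2)) ≡ + g₁ + (+ 3 * + ℓ + + 2)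
  cast₁ = trans (pos-+ g₁ _) (cong (λ x → + g₁ + x) (trans (pos-+ (3 ℕ.* ℓ) 2) (cong (_+ + 2) (pos-* 3 ℓ))))

γ₂′-+ : ∀ a₀ a₁ b₀ b₁ y → (γ₂′ (a₀ ℕ.+ b₀) (a₁ ℕ.+ b₁) + y) + + 16 ≡ (γ₂′ a₀ a₁ + γ₂′ b₀ b₁) + y
γ₂′-+ a₀ a₁ b₀ b₁ y = begin
  (γ₂′ (a₀ ℕ.+ b₀) (a₁ ℕ.+ b₁) + y) + + 16
    ≡⟨ cong (λ x → (x + y) + + 16) (trans (γ₂′≡ (a₀ ℕ.+ b₀) (a₁ ℕ.+ b₁))
                                          (cong₂ (λ x₁ x₀ → (x₁ - + 5 * x₀) + + 16) (pos-+ a₁ b₁) (pos-+ a₀ b₀))) ⟩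
  ((((+ a₁ + + b₁) - + 5 * (+ a₀ + + b₀)) + + 16) + y) + + 16
    ≡⟨ identity (+ a₀) (+ a₁) (+ b₀) (+ b₁) y ⟩
  ((+ a₁ - + 5 * + a₀) + + 16 + ((+ b₁ - + 5 * + b₀) + + 16)) + y
    ≡⟨ cong₂ (λ x z → (x + z) + y) (γ₂′≡ a₀ a₁) (γ₂′≡ b₀ b₁) ⟨
  (γ₂′ a₀ a₁ + γ₂′ b₀ b₁) + y ∎
  where
  open ≡-Reasoning
  identity : ∀ a₀ a₁ b₀ b₁ y → ((((a₁ + b₁) - + 5 * (a₀ + b₀)) + + 16) + y) + + 16 ≡
             ((a₁ - + 5 * a₀) + + 16 + ((b₁ - + 5 * b₀) + + 16)) + y
  identity = solve-∀

lemma5p9 : ((n₁ n₂ m : ℕ) (Δ₁ : Cx n₁) (Δ₂ : Cx n₂) (e₁ : Subset n₁) (e₂ : Subset n₂)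
    (φ : Fin n₁ → Fin n₂) (φ⁻ : Fin n₂ → Fin n₁)
    (Γ : Cx m) (π₁ : Fin n₁ → Fin m) (π₂ : Fin n₂ → Fin m) →
    IsFlag3Manifold Δ₁ → IsFlag3Manifold Δ₂ →
    IsEdge Δ₁ e₁ → IsEdge Δ₂ e₂ →
    IsSimpIso (bst e₁ Δ₁) (bst e₂ Δ₂) φ φ⁻ →
    IsConnSum Δ₁ Δ₂ e₁ e₂ φ Γ π₁ π₂ →
    γ₂ Γ ≡ (γ₂ Δ₁ + γ₂ Δ₂) + + 2 * γ₁ (lk e₁ Δ₁))
    × ((n m : ℕ) (Δ : Cx n) (σ₁ σ₂ : Subset n) (ψ ψ⁻ : Fin n → Fin n)
    (Γ : Cx m) (π : Fin n → Fin m) →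
    IsFlag3Manifold Δ →
    IsEdge Δ σ₁ → IsEdge Δ σ₂ →
    IsSimpIso (bst σ₁ Δ) (bst σ₂ Δ) ψ ψ⁻ →
    DistGe4 Δ (vertexSet (st σ₁ Δ)) (vertexSet (st σ₂ Δ)) →
    IsHandleAdd Δ σ₁ σ₂ ψ Γ π →
    γ₂ Γ ≡ (γ₂ Δ + + 2 * γ₁ (lk σ₁ Δ)) + + 16)
lemma5p9 =
  (λ n₁ n₂ m Δ₁ Δ₂ e₁ e₂ φ φ⁻ Γ π₁ π₂ M₁ M₂ E₁ E₂ iso sum → let open ConnectedSum M₁ M₂ E₁ E₂ iso sum in
     trans (γ₂-glue Γ (f (lk e₁ Δ₁) 0) f₀-Γ f₁-Γ)
           (γ₂′-+ (f Δ₁ 0) (f Δ₁ 1) (f Δ₂ 0) (f Δ₂ 1) (+ 2 * γ₁ (lk e₁ Δ₁)))) ,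
  (λ n m Δ σ₁ σ₂ ψ ψ⁻ Γ π M E₁ E₂ iso far handle → let open HandleAddition M E₁ E₂ iso far handle in
     γ₂-glue Γ (f (lk σ₁ Δ) 0) f₀-Γ f₁-Γ)
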